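{- For every prime $p$ there exist $\varepsilon(p),\delta(p)\in(0,\infty)$ such that the following holds. Let $n\geq p^2$ be an integer, let $\Gamma=\mathbb{F}_p^n$ (written additively), let $\mathbf{1}=(1,\dots,1)\in\mathbb{Z}^p$, and let $C\in\mathbb{Z}^{(p-2)\times p}$ be the matrix whose $i$-th row ($i=1,\dots,p-2$) has entries $1,-2,1$ in columns $i,i+1,i+2$ and $0$ elsewhere. Then for every $\varepsilon<\varepsilon(p)$, every $(C,\mathbf{1},\Gamma,\varepsilon)$-arithmetic expander has size (number of elements counted with multiplicity) at least $\delta(p)\,n^{p-1}$.
   Context: Multilinear norms: for a $t$-linear form $A$ on $\mathbb{R}^N$ and $r\in[1,\infty]$, $\|A\|_{\ell_r,\dots,\ell_r}=\sup\{A(x[1],\dots,x[t])/(\|x[1]\|_{\ell_r}\cdots\|x[t]\|_{\ell_r}) : x[1],\dots,x[t]\in\mathbb{R}^N\setminus\{0\}\}$. Permutation hypergraphs: for a finite set $V$ and permutations $\pi_1,\dots,\pi_t$ of $V$, the associated $t$-uniform hypergraph has unnormalized adjacency form the $t$-linear form $\overline{A}$ on $\mathbb{R}^V$ determined by $\overline{A}(1_{\{u_1\}},\dots,1_{\{u_t\}})=\sum_{\sigma\in S_t}\sum_{v\in V}\prod_{j=1}^t 1[u_j=\pi_{\sigma(j)}(v)]$; a union of such hypergraphs has as unnormalized adjacency form the sum of theirs. A hypergraph is $k$-regular if $\overline{A}(1_{\{v\}},1_V,\dots,1_V)=k$ for every vertex $v$, and then its normalized adjacency form is $A=\overline{A}/k$.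 Cayley hypergraphs over an abelian group $\Gamma$: for $q\in(\mathbb{Z}\setminus\{0\})^t$ and $\mathbf{g}=(g[1],\dots,g[t])\in\Gamma^t$, $\mathrm{Cay}^{(t)}(\Gamma,q,\{\mathbf g\})$ is the hypergraph on $\Gamma$ given by the permutations $\pi_j(u)=q_ju+g[j]$; for a multiset $S=\{\mathbf g_1,\dots,\mathbf g_k\}\subseteq\Gamma^t$, $\mathrm{Cay}^{(t)}(\Gamma,q,S)$ is the union over $i\in[k]$ of $\mathrm{Cay}^{(t)}(\Gamma,q,\{\mathbf g_i\})$; it is $(t!)k$-regular. For regular $t$-uniform hypergraphs $K,H$ on the same vertex set with normalized adjacency forms $A_K,A_H$, set $\lambda_K(H)=\|A_H-A_K\|_{\ell_t,\dots,\ell_t}$. Arithmetic expanders (case at hand): the solution set $\{\mathbf h\in\Gamma^p: C\mathbf h=0\}$ (the $p$-term arithmetic progressions) is a union of cosets of $\{(u,\dots,u):u\in\Gamma\}$, with set of coset representatives $S=\{(0,v,2v,\dots,(p-1)v): v\in\Gamma\}$. Let $K=\mathrm{Cay}^{(p)}(\Gamma,\mathbf 1,S)$. A multiset $S'$ of elements of $S$ is a $(C,\mathbf{1},\Gamma,\varepsilon)$-arithmetic expander if $\lambda_K(\mathrm{Cay}^{(p)}(\Gamma,\mathbf 1,S'))\leq\varepsilon$.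
   Formalization: The parameter ε ranges over the rationals, the constants $\varepsilon(p)$ and $\delta(p)$ are taken rational, and the test vectors in the multilinear norm have rational entries rather than real ones. -}

module Defs where

open import Data.Nat as ℕ using (ℕ; zero; suc; NonZero; _!)
open import Data.Nat.DivMod using (_mod_)
open import Data.Integer using (+_)
open import Data.Fin using (Fin; zero; suc; toℕ; _≟_)
open import Data.Rational using (ℚ; 0ℚ; 1ℚ; _+_; _*_; _-_; ∣_∣; _/_; _≤_)
open import Data.Bool using (Bool; true; false; _∧_; if_then_else_)
open import Data.List using (List; []; _∷_; length)
open import Data.Product using (_×_)
open import Data.Vec.Functional using () renaming (_∷_ to _◂_)
open import Relation.Nullary.Decidable using (⌊_⌋)

sumFin : (m : ℕ) → (Fin m → ℚ) → ℚ
sumFin zero    f = 0ℚ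
sumFin (suc m) f = f zero + sumFin m (λ i → f (suc i))

prodFin : (m : ℕ) → (Fin m → ℚ) → ℚ
prodFin zero    f = 1ℚ
prodFin (suc m) f = f zero * prodFin m (λ i → f (suc i))

sumFun : (k m : ℕ) → ((Fin k → Fin m) → ℚ) → ℚ
sumFun zero    m f = f (λ ())
sumFun (suc k) m f = sumFin m (λ a → sumFun k m (λ g → f (a ◂ g)))

allFinB : (m : ℕ) → (Fin m → Bool) → Bool
allFinB zero    f = true
allFinB (suc m) f = f zero ∧ allFinB m (λ i → f (suc i))

isPerm : (m : ℕ) → (Fin m → Fin m) → Bool
isPerm m σ = allFinB m (λ i → allFinB m (λ j →
  if ⌊ σ i ≟ σ j ⌋ then ⌊ i ≟ j ⌋ else true))

sumPerm : (m : ℕ) → ((Fin m → Fin m) → ℚ) → ℚ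
sumPerm m f = sumFun m m (λ σ → if isPerm m σ then f σ else 0ℚ)

ℕtoℚ : ℕ → ℚ
ℕtoℚ k = (+ k) / 1

-- 1/d for d ≠ 0 (only ever used with d ≠ 0)
inv : ℕ → ℚ
inv zero    = 0ℚ
inv (suc d) = (+ 1) / suc d

_^ℚ_ : ℚ → ℕ → ℚ
x ^ℚ zero  = 1ℚ
x ^ℚ suc k = x * (x ^ℚ k)

module _ (p : ℕ) .{{_ : NonZero p}} where

  Γ : ℕ → Set
  Γ n = Fin n → Fin p

  addΓ : {n : ℕ} → Γ n → Γ n → Γ n
  addΓ u v i = (toℕ (u i) ℕ.+ toℕ (v i)) mod p

  scaleΓ : {n : ℕ} → ℕ → Γ n → Γ n
  scaleΓ k v i = (k ℕ.* toℕ (v i)) mod p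

  sumΓ : (n : ℕ) → (Γ n → ℚ) → ℚ
  sumΓ n f = sumFun n p f

  -- Unnormalised adjacency form of the permutation hypergraph
  -- Cay^(p)(Γ, 1, {g_v}) with g_v = (0, v, 2v, …, (p-1)v), i.e.
  -- π_j(u) = u + j·v  (j ∈ Fin p, 0-indexed):
  --   Ā(x_1,…,x_p) = Σ_{σ ∈ S_p} Σ_{u ∈ Γ} Π_j x_j(π_{σ(j)}(u)).
  barAv : (n : ℕ) → Γ n → (Fin p → Γ n → ℚ) → ℚ
  barAv n v x = sumPerm p (λ σ → sumΓ n (λ u →
    prodFin p (λ j → x j (addΓ u (scaleΓ (toℕ (σ j)) v)))))

  -- The multiset S' ⊆ S is encoded by the list of the v's of its elements
  -- (v ↦ (0,v,…,(p-1)v) is a bijection Γ → S).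
  -- Unnormalised form of Cay^(p)(Γ,1,S') : sum over the multiset.
  barA : (n : ℕ) → List (Γ n) → (Fin p → Γ n → ℚ) → ℚ
  barA n []       x = 0ℚ
  barA n (v ∷ vs) x = barAv n v x + barA n vs x

  -- Normalised form of H = Cay^(p)(Γ,1,S'), which is (p!)|S'|-regular.
  AH : (n : ℕ) → List (Γ n) → (Fin p → Γ n → ℚ) → ℚ
  AH n S' x = barA n S' x * inv ((p !) ℕ.* length S')

  -- Normalised form of K = Cay^(p)(Γ,1,S), S = {g_v : v ∈ Γ}, which is
  -- (p!)·p^n-regular.
  AK : (n : ℕ) → (Fin p → Γ n → ℚ) → ℚ
  AK n x = sumΓ n (λ v → barAv n v x) * inv ((p !) ℕ.* (p ℕ.^ n))

  normPow : (n : ℕ) → (Γ n → ℚ) → ℚ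
  normPow n y = sumΓ n (λ u → ∣ y u ∣ ^ℚ p)

  -- λ_K(H) ≤ ε, i.e. ‖A_H − A_K‖_{ℓ_p,…,ℓ_p} ≤ ε, written without p-th roots:
  -- ε ≥ 0 and |(A_H − A_K)(x)|^p ≤ ε^p Π_j ‖x_j‖_p^p for all x
  -- (test vectors taken rational).
  normLe : (n : ℕ) → List (Γ n) → ℚ → Set
  normLe n S' ε = (0ℚ ≤ ε) × ((x : Fin p → Γ n → ℚ) →
    (∣ AH n S' x - AK n x ∣ ^ℚ p) ≤ ((ε ^ℚ p) * prodFin p (λ j → normPow n (x j))))

  -- S' is a (C,1,Γ,ε)-arithmetic expander (C the second-difference matrix,
  -- whose progression coset representatives are S).  S' must be nonempty
  -- for H to be a regular hypergraph with a normalised form.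
  data NonEmpty {A : Set} : List A → Set where
    nonEmpty : ∀ {a as} → NonEmpty (a ∷ as)

  IsArithExpander : (n : ℕ) → ℚ → List (Γ n) → Set
  IsArithExpander n ε S' = NonEmpty S' × normLe n S' ε

{-# OPTIONS --safe #-}
module Submission where

-- Let d = p - 1, m = n / p, and use d·m of the n coordinates as d disjoint blocks of size m.
-- A block form F(w) = Σ_t T_t Π_k w(k, t_k), taking one coordinate from each block, has m^d
-- coefficients, so if the expander S' has fewer than m^d elements, pigeonhole gives a block form
-- with a coefficient T_t₀ ≢ 0 (mod p) that vanishes on S'.  As F is homogeneous of degree p - 1,
-- Σ_{j ∈ 𝔽_p} F(u + j v) ≡ (p - 1)! F(v): expand Π_k (a_k + j b_k) in the binomial basis C(j, r) and
-- use Σ_{j<p} C(j, r) = C(p, r + 1).  Colour the points of 𝔽_p^n by F mod p and test the expander on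
-- the indicators x_j of the colour classes a_j with Σ_j a_j ≢ 0.  The Cayley hypergraph of S' sees no
-- such edge, since colours along a line through v ∈ S' sum to (p - 1)! F(v) ≡ 0, while the complete
-- one sees every pair (u, v) with F(v) ≢ 0.  Taking iterated differences in the d variables of the
-- monomial t₀ shows F(v) ≢ 0 for at least a (2p)^-d fraction of all v, which forces
-- λ_K(H) ≥ 1 / (p! p^p (2p)^d).  Hence |S'| ≥ m^d ≥ (n / 2p)^d.

open import Defs

-- The development lives in an anonymous module so that its ℕ operators stay out of scope
-- of the statement at the end, which uses the ℚ ones.
module _ where

  open import Data.Nat as ℕ using (ℕ; zero; suc; _+_; _*_; _^_; _∸_; _≤_; _<_; z≤n; s≤s; NonZero; _%_; _/_; _!)
  open import Data.Nat.Properties hiding (_≟_)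
  open import Data.Nat.DivMod
    using (_mod_; %-distribˡ-+; %-distribˡ-*; m*n%n≡0; m%n%n≡m%n; [m+kn]%n≡m%n; m%n<n; m<n⇒m%n≡m; m/n*n≤m; m≥n⇒m/n>0; m≡m%n+[m/n]*n)
  open import Data.Nat.Divisibility using (_∣_; _∤_; divides; ∣⇒≤; n∣m⇒m%n≡0; m%n≡0⇒n∣m)
  open import Data.Nat.Combinatorics using (_C_; nC1≡n; nCn≡1; nCk+nC[k+1]≡[n+1]C[k+1])
  import Data.Nat.Coprimality as Coprime
  open import Data.Nat.Primality using (Prime; euclidsLemma; prime⇒nonTrivial)
  open import Data.Nat.Tactic.RingSolver using (solve-∀)
  import Data.Integer as ℤ
  import Data.Integer.Properties as ℤₚ
  open import Data.Rational as ℚ using (ℚ; 0ℚ; 1ℚ; mkℚ; *≤*)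
  import Data.Rational.Properties as ℚₚ
  import Data.Rational.Unnormalised as ℚᵘ
  import Data.Rational.Unnormalised.Properties as ℚᵘₚ
  open import Data.Fin using (Fin; zero; suc; toℕ; _≟_; inject₁; fromℕ; fromℕ<; inject≤; combine; punchOut; finToFun; funToFin)
  import Data.Fin.Properties as Finₚ
  open import Data.Fin.Permutation using (Permutation′)
  open import Data.Vec.Functional using (updateAt) renaming (_∷_ to _◂_)
  open import Data.Vec.Functional.Properties using (updateAt-updates; updateAt-minimal)
  open import Data.List using (List; []; _∷_; length; lookup)
  open import Data.Bool using (Bool; true; false; _∧_; if_then_else_)
  open import Data.Product using (∃; ∃₂; _×_; _,_; proj₁; proj₂)
  open import Data.Sum using (_⊎_; inj₁; inj₂)
  open import Function using (_∘_; id; const)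
  open import Function.Bundles using (mk↔ₛ′)
  open import Relation.Nullary.Decidable using (Dec; ⌊_⌋; yes; no)
  open import Relation.Nullary.Negation using (¬_; contradiction)
  open import Relation.Binary.PropositionalEquality
  open import Algebra.Bundles using (CommutativeMonoid)
  open import Algebra.Properties.CommutativeSemigroup *-commutativeSemigroup using (x∙yz≈y∙xz; interchange)
  open import Algebra.Properties.CommutativeSemigroup (CommutativeMonoid.commutativeSemigroup ℚₚ.*-1-commutativeMonoid)
    using () renaming (interchange to ℚ-interchange)
  open import Algebra.Properties.Semiring.Sum +-*-semiring
    using (sum; sum-syntax; sum-cong-≗; ∑-distrib-+; ∑-comm; ∑-permute; sum-init-last; *-distribˡ-sum; *-distribʳ-sum)
  open import Algebra.Properties.CommutativeMonoid.Sum *-1-commutativeMonoid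
    using () renaming (sum to ∏; sum-cong-≗ to ∏-cong; ∑-distrib-+ to ∏-distrib-*)

  ∑-const : ∀ m c → ∑[ i < m ] c ≡ m * c
  ∑-const zero    c = refl
  ∑-const (suc m) c = cong (c +_) (∑-const m c)

  ∑-mono-≤ : ∀ {m} {f g : Fin m → ℕ} → (∀ i → f i ≤ g i) → sum f ≤ sum g
  ∑-mono-≤ {zero}  f≤g = z≤n
  ∑-mono-≤ {suc m} f≤g = +-mono-≤ (f≤g zero) (∑-mono-≤ (f≤g ∘ suc))

  term≤∑ : ∀ {m} (f : Fin m → ℕ) i → f i ≤ sum f
  term≤∑ f zero    = m≤m+n _ _
  term≤∑ f (suc i) = ≤-trans (term≤∑ (f ∘ suc) i) (m≤n+m _ _)

  ∑≡0⇒≡0 : ∀ {m} (f : Fin m → ℕ) → sum f ≡ 0 → ∀ i → f i ≡ 0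
  ∑≡0⇒≡0 f eq zero    = m+n≡0⇒m≡0 _ eq
  ∑≡0⇒≡0 f eq (suc i) = ∑≡0⇒≡0 (f ∘ suc) (m+n≡0⇒n≡0 (f zero) eq) i

  ∏-const : ∀ m c → ∏ {m} (λ _ → c) ≡ c ^ m
  ∏-const zero    c = refl
  ∏-const (suc m) c = cong (c *_) (∏-const m c)

  ∏-mono-≤ : ∀ {m} {f g : Fin m → ℕ} → (∀ i → f i ≤ g i) → ∏ f ≤ ∏ g
  ∏-mono-≤ {zero}  f≤g = ≤-refl
  ∏-mono-≤ {suc m} f≤g = *-mono-≤ (f≤g zero) (∏-mono-≤ (f≤g ∘ suc))

  ∏-zero : ∀ {m} (f : Fin m → ℕ) i → f i ≡ 0 → ∏ f ≡ 0
  ∏-zero f zero    eq = cong (_* ∏ (f ∘ suc)) eq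
  ∏-zero f (suc i) eq = trans (cong (f zero *_) (∏-zero (f ∘ suc) i eq)) (*-zeroʳ (f zero))

  kronecker : ∀ {m} → Fin m → Fin m → ℕ
  kronecker a b = if ⌊ a ≟ b ⌋ then 1 else 0

  kronecker-refl : ∀ {m} (a : Fin m) → kronecker a a ≡ 1
  kronecker-refl a with a ≟ a
  ... | yes _  = refl
  ... | no a≢a = contradiction refl a≢a

  kronecker-≢ : ∀ {m} {a b : Fin m} → a ≢ b → kronecker a b ≡ 0
  kronecker-≢ {a = a} {b} a≢b with a ≟ b
  ... | yes a≡b = contradiction a≡b a≢b
  ... | no _    = refl

  kronecker-suc : ∀ {m} (a b : Fin m) → kronecker (suc a) (suc b) ≡ kronecker a b
  kronecker-suc a b with a ≟ b
  ... | yes _ = refl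
  ... | no _  = refl

  kronecker^≤1 : ∀ {m} (a b : Fin m) e → kronecker a b ^ e ≤ 1
  kronecker^≤1 a b e with a ≟ b
  ... | yes _ = ≤-reflexive (^-zeroˡ e)
  kronecker^≤1 a b zero    | no _ = ≤-refl
  kronecker^≤1 a b (suc e) | no _ = z≤n

  ∑-kronecker : ∀ {m} (a : Fin m) (g : Fin m → ℕ) → ∑[ b < m ] (kronecker a b * g b) ≡ g a
  ∑-kronecker {suc m} zero    g =
    trans (cong₂ _+_ (+-identityʳ (g zero)) (trans (∑-const m 0) (*-zeroʳ m))) (+-identityʳ (g zero))
  ∑-kronecker {suc m} (suc a) g =
    trans (sum-cong-≗ (λ b → cong (_* g (suc b)) (kronecker-suc a b))) (∑-kronecker a (g ∘ suc))

  sumFunℕ : ∀ k m → ((Fin k → Fin m) → ℕ) → ℕ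
  sumFunℕ zero    m f = f (λ ())
  sumFunℕ (suc k) m f = ∑[ a < m ] sumFunℕ k m (λ g → f (a ◂ g))

  Extensional : ∀ {k m} → ((Fin k → Fin m) → ℕ) → Set
  Extensional f = ∀ {g h} → (∀ i → g i ≡ h i) → f g ≡ f h

  module _ {m : ℕ} where

    ◂-extensional : ∀ {k} {f : (Fin (suc k) → Fin m) → ℕ} → Extensional f → ∀ a → Extensional (λ g → f (a ◂ g))
    ◂-extensional f-ext a g≗h = f-ext λ { zero → refl ; (suc i) → g≗h i }

    ◂-head-tail : ∀ {k} {f : (Fin (suc k) → Fin m) → ℕ} → Extensional f → ∀ g → f (g zero ◂ (g ∘ suc)) ≡ f g
    ◂-head-tail f-ext g = f-ext λ { zero → refl ; (suc i) → refl }

    sumFunℕ-cong : ∀ k {f g : (Fin k → Fin m) → ℕ} → (∀ z → f z ≡ g z) → sumFunℕ k m f ≡ sumFunℕ k m g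
    sumFunℕ-cong zero    f≗g = f≗g _
    sumFunℕ-cong (suc k) f≗g = sum-cong-≗ {m} λ a → sumFunℕ-cong k (f≗g ∘ (a ◂_))

    sumFunℕ-*ˡ : ∀ k c (f : (Fin k → Fin m) → ℕ) → c * sumFunℕ k m f ≡ sumFunℕ k m (λ z → c * f z)
    sumFunℕ-*ˡ zero    c f = refl
    sumFunℕ-*ˡ (suc k) c f = trans (*-distribˡ-sum c (λ a → sumFunℕ k m (λ g → f (a ◂ g)))) (sum-cong-≗ {m} λ a → sumFunℕ-*ˡ k c _)

    sumFunℕ-const : ∀ k c → sumFunℕ k m (λ _ → c) ≡ m ^ k * c
    sumFunℕ-const zero    c = sym (+-identityʳ c)
    sumFunℕ-const (suc k) c = begin
      ∑[ a < m ] sumFunℕ k m (λ _ → c) ≡⟨ sum-cong-≗ {m} (λ a → sumFunℕ-const k c) ⟩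
      ∑[ a < m ] (m ^ k * c)           ≡⟨ ∑-const m _ ⟩
      m * (m ^ k * c)                  ≡⟨ *-assoc m _ c ⟨
      m ^ suc k * c                    ∎
      where open ≡-Reasoning

    sumFunℕ-mono-≤ : ∀ k {f g : (Fin k → Fin m) → ℕ} → (∀ z → f z ≤ g z) → sumFunℕ k m f ≤ sumFunℕ k m g
    sumFunℕ-mono-≤ zero    f≤g = f≤g _
    sumFunℕ-mono-≤ (suc k) f≤g = ∑-mono-≤ λ a → sumFunℕ-mono-≤ k (f≤g ∘ (a ◂_))

    sumFunℕ-∑-comm : ∀ k r (f : (Fin k → Fin m) → Fin r → ℕ) →
      sumFunℕ k m (λ z → ∑[ i < r ] f z i) ≡ ∑[ i < r ] sumFunℕ k m (λ z → f z i)
    sumFunℕ-∑-comm zero    r f = refl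
    sumFunℕ-∑-comm (suc k) r f = trans (sum-cong-≗ {m} λ a → sumFunℕ-∑-comm k r _) (∑-comm (λ a i → sumFunℕ k m (λ g → f (a ◂ g) i)))

    term≤sumFunℕ : ∀ k (f : (Fin k → Fin m) → ℕ) → Extensional f → ∀ z → f z ≤ sumFunℕ k m f
    term≤sumFunℕ zero    f f-ext z = ≤-reflexive (f-ext λ ())
    term≤sumFunℕ (suc k) f f-ext z = begin
      f z                                ≡⟨ ◂-head-tail f-ext z ⟨
      f (z zero ◂ (z ∘ suc))             ≤⟨ term≤sumFunℕ k _ (◂-extensional f-ext (z zero)) (z ∘ suc) ⟩
      sumFunℕ k m (λ g → f (z zero ◂ g)) ≤⟨ term≤∑ (λ a → sumFunℕ k m (λ g → f (a ◂ g))) (z zero) ⟩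
      sumFunℕ (suc k) m f                ∎
      where open ≤-Reasoning

    sumFunℕ-kronecker : ∀ k (y : Fin k → Fin m) (h : (Fin k → Fin m) → ℕ) → Extensional h →
      sumFunℕ k m (λ z → ∏ (λ j → kronecker (y j) (z j)) * h z) ≡ h y
    sumFunℕ-kronecker zero    y h h-ext = trans (+-identityʳ _) (h-ext λ ())
    sumFunℕ-kronecker (suc k) y h h-ext = begin
      ∑[ b < m ] sumFunℕ k m (λ z → kronecker (y zero) b * ∏ (λ j → kronecker (y (suc j)) (z j)) * h (b ◂ z))
        ≡⟨ sum-cong-≗ {m} (λ b → trans (sumFunℕ-cong k λ z → *-assoc (kronecker (y zero) b) _ _) (sym (sumFunℕ-*ˡ k (kronecker (y zero) b) _))) ⟩
      ∑[ b < m ] (kronecker (y zero) b * sumFunℕ k m (λ z → ∏ (λ j → kronecker (y (suc j)) (z j)) * h (b ◂ z)))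
        ≡⟨ sum-cong-≗ {m} (λ b → cong (kronecker (y zero) b *_) (sumFunℕ-kronecker k (y ∘ suc) _ (◂-extensional h-ext b))) ⟩
      ∑[ b < m ] (kronecker (y zero) b * h (b ◂ (y ∘ suc)))
        ≡⟨ ∑-kronecker (y zero) (λ b → h (b ◂ (y ∘ suc))) ⟩
      h (y zero ◂ (y ∘ suc))
        ≡⟨ ◂-head-tail h-ext y ⟩
      h y ∎
      where open ≡-Reasoning

    sumFunℕ-∏ : ∀ k (H : Fin k → Fin m → ℕ) → sumFunℕ k m (λ z → ∏ (λ j → H j (z j))) ≡ ∏ (λ j → sum (H j))
    sumFunℕ-∏ zero    H = refl
    sumFunℕ-∏ (suc k) H = begin
      ∑[ a < m ] sumFunℕ k m (λ z → H zero a * ∏ (λ j → H (suc j) (z j)))   ≡⟨ sum-cong-≗ {m} (λ a → sumFunℕ-*ˡ k (H zero a) _) ⟨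
      ∑[ a < m ] (H zero a * sumFunℕ k m (λ z → ∏ (λ j → H (suc j) (z j)))) ≡⟨ sum-cong-≗ {m} (λ a → cong (H zero a *_) (sumFunℕ-∏ k (H ∘ suc))) ⟩
      ∑[ a < m ] (H zero a * ∏ (λ j → sum (H (suc j))))                     ≡⟨ *-distribʳ-sum (∏ (λ j → sum (H (suc j)))) (H zero) ⟨
      sum (H zero) * ∏ (λ j → sum (H (suc j)))                              ∎
      where open ≡-Reasoning

    sumFunℕ-*≡0 : ∀ k (f g : (Fin k → Fin m) → ℕ) → sumFunℕ k m f ≡ 0 → sumFunℕ k m (λ z → g z * f z) ≡ 0
    sumFunℕ-*≡0 zero    f g eq = trans (cong (g (λ ()) *_) eq) (*-zeroʳ (g (λ ())))
    sumFunℕ-*≡0 (suc k) f g eq = begin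
      ∑[ a < m ] sumFunℕ k m (λ z → g (a ◂ z) * f (a ◂ z)) ≡⟨ sum-cong-≗ {m} (λ a → sumFunℕ-*≡0 k _ (g ∘ (a ◂_)) (∑≡0⇒≡0 _ eq a)) ⟩
      ∑[ a < m ] 0                                         ≡⟨ ∑-const m 0 ⟩
      m * 0                                                ≡⟨ *-zeroʳ m ⟩
      0                                                    ∎
      where open ≡-Reasoning

  sumFunℕ-comm : ∀ k m k′ m′ (f : (Fin k → Fin m) → (Fin k′ → Fin m′) → ℕ) →
    sumFunℕ k m (λ g → sumFunℕ k′ m′ (f g)) ≡ sumFunℕ k′ m′ (λ h → sumFunℕ k m (λ g → f g h))
  sumFunℕ-comm k m zero     m′ f = refl
  sumFunℕ-comm k m (suc k′) m′ f =
    trans (sumFunℕ-∑-comm k m′ _) (sum-cong-≗ {m′} λ a → sumFunℕ-comm k m k′ m′ λ g h → f g (a ◂ h))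

  -- Binomial moments of products of linear forms

  [1+k]*[1+n]C[1+k]≡[1+n]*nCk : ∀ n k → suc k * (suc n C suc k) ≡ suc n * (n C k)
  [1+k]*[1+n]C[1+k]≡[1+n]*nCk zero    zero    = refl
  [1+k]*[1+n]C[1+k]≡[1+n]*nCk zero    (suc k) = *-zeroʳ (suc (suc k))
  [1+k]*[1+n]C[1+k]≡[1+n]*nCk (suc n) zero    =
    trans (+-identityʳ _) (trans (nC1≡n (suc (suc n))) (sym (*-identityʳ _)))
  [1+k]*[1+n]C[1+k]≡[1+n]*nCk (suc n) (suc k) = begin
    suc (suc k) * (suc (suc n) C suc (suc k))
      ≡⟨ cong (suc (suc k) *_) (nCk+nC[k+1]≡[n+1]C[k+1] (suc n) (suc k)) ⟨
    suc (suc k) * (suc n C suc k + suc n C suc (suc k))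
      ≡⟨ *-distribˡ-+ (suc (suc k)) (suc n C suc k) _ ⟩
    suc n C suc k + suc k * (suc n C suc k) + suc (suc k) * (suc n C suc (suc k))
      ≡⟨ cong₂ (λ x y → suc n C suc k + x + y) ([1+k]*[1+n]C[1+k]≡[1+n]*nCk n k) ([1+k]*[1+n]C[1+k]≡[1+n]*nCk n (suc k)) ⟩
    suc n C suc k + suc n * (n C k) + suc n * (n C suc k)
      ≡⟨ cong (λ x → x + suc n * (n C k) + suc n * (n C suc k)) (nCk+nC[k+1]≡[n+1]C[k+1] n k) ⟨
    n C k + n C suc k + suc n * (n C k) + suc n * (n C suc k)
      ≡⟨ regroup (n C k) (n C suc k) n ⟩
    suc (suc n) * (n C k + n C suc k)
      ≡⟨ cong (suc (suc n) *_) (nCk+nC[k+1]≡[n+1]C[k+1] n k) ⟩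
    suc (suc n) * (suc n C suc k) ∎
    where
    open ≡-Reasoning
    regroup : ∀ x y n → x + y + suc n * x + suc n * y ≡ suc (suc n) * (x + y)
    regroup = solve-∀

  n*nCr≡[1+r]*nC[1+r]+r*nCr : ∀ n r → n * (n C r) ≡ suc r * (n C suc r) + r * (n C r)
  n*nCr≡[1+r]*nC[1+r]+r*nCr zero    zero    = refl
  n*nCr≡[1+r]*nC[1+r]+r*nCr zero    (suc r) = sym (cong₂ _+_ (*-zeroʳ (suc (suc r))) (*-zeroʳ (suc r)))
  n*nCr≡[1+r]*nC[1+r]+r*nCr (suc n) zero    = begin
    suc n * 1               ≡⟨ *-identityʳ (suc n) ⟩
    suc n                   ≡⟨ nC1≡n (suc n) ⟨
    suc n C 1               ≡⟨ trans (+-identityʳ _) (+-identityʳ _) ⟨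
    1 * (suc n C 1) + 0 * 1 ∎
    where open ≡-Reasoning
  n*nCr≡[1+r]*nC[1+r]+r*nCr (suc n) (suc r) = begin
    suc n * (suc n C suc r)                                       ≡⟨ cong (suc n *_) (nCk+nC[k+1]≡[n+1]C[k+1] n r) ⟨
    suc n * (n C r + n C suc r)                                   ≡⟨ *-distribˡ-+ (suc n) (n C r) _ ⟩
    suc n * (n C r) + suc n * (n C suc r)                         ≡⟨ +-comm (suc n * (n C r)) _ ⟩
    suc n * (n C suc r) + suc n * (n C r)                         ≡⟨ cong₂ _+_ ([1+k]*[1+n]C[1+k]≡[1+n]*nCk n (suc r)) ([1+k]*[1+n]C[1+k]≡[1+n]*nCk n r) ⟨
    suc (suc r) * (suc n C suc (suc r)) + suc r * (suc n C suc r) ∎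
    where open ≡-Reasoning

  ∑[j<n]jCr≡nC[1+r] : ∀ n r → ∑[ j < n ] (toℕ j C r) ≡ n C suc r
  ∑[j<n]jCr≡nC[1+r] zero    r = refl
  ∑[j<n]jCr≡nC[1+r] (suc n) r = begin
    ∑[ j < suc n ] (toℕ j C r)
      ≡⟨ sum-init-last (λ j → toℕ j C r) ⟩
    ∑[ j < n ] (toℕ (inject₁ j) C r) + toℕ (fromℕ n) C r
      ≡⟨ cong₂ _+_ (sum-cong-≗ {n} (cong (_C r) ∘ Finₚ.toℕ-inject₁)) (cong (_C r) (Finₚ.toℕ-fromℕ n)) ⟩
    ∑[ j < n ] (toℕ j C r) + n C r
      ≡⟨ cong (_+ n C r) (∑[j<n]jCr≡nC[1+r] n r) ⟩
    n C suc r + n C r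
      ≡⟨ +-comm (n C suc r) _ ⟩
    n C r + n C suc r
      ≡⟨ nCk+nC[k+1]≡[n+1]C[k+1] n r ⟩
    suc n C suc r ∎
    where open ≡-Reasoning

  linProd : ∀ d → (Fin d → ℕ) → (Fin d → ℕ) → ℕ → ℕ
  linProd d a b j = ∏ (λ k → a k + j * b k)

  binomialMoment : ∀ q d → (Fin d → ℕ) → (Fin d → ℕ) → ℕ → ℕ
  binomialMoment q d a b r = ∑[ j < q ] ((toℕ j C r) * linProd d a b (toℕ j))

  binomialMoment-zero : ∀ q (a b : Fin 0 → ℕ) r → binomialMoment q 0 a b r ≡ q C suc r
  binomialMoment-zero q a b r = trans (sum-cong-≗ {q} λ j → *-identityʳ (toℕ j C r)) (∑[j<n]jCr≡nC[1+r] q r)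

  binomialMoment-suc : ∀ q d (a b : Fin (suc d) → ℕ) r →
    let M = binomialMoment q d (a ∘ suc) (b ∘ suc) in
    binomialMoment q (suc d) a b r ≡ a zero * M r + b zero * (suc r * M (suc r)) + b zero * (r * M r)
  binomialMoment-suc q d a b r = begin
    ∑[ j < q ] (x j * ((a₀ + toℕ j * b₀) * e j))
      ≡⟨ sum-cong-≗ {q} (λ j → expand (x j) (toℕ j) a₀ b₀ (e j)) ⟩
    ∑[ j < q ] (a₀ * (x j * e j) + b₀ * (toℕ j * x j * e j))
      ≡⟨ sum-cong-≗ {q} (λ j → cong (λ s → a₀ * (x j * e j) + b₀ * (s * e j)) (n*nCr≡[1+r]*nC[1+r]+r*nCr (toℕ j) r)) ⟩
    ∑[ j < q ] (a₀ * (x j * e j) + b₀ * ((suc r * y j + r * x j) * e j))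
      ≡⟨ sum-cong-≗ {q} (λ j → split a₀ b₀ (x j) (y j) (e j) r) ⟩
    ∑[ j < q ] (a₀ * (x j * e j) + b₀ * (suc r * (y j * e j)) + b₀ * (r * (x j * e j)))
      ≡⟨ trans (∑-distrib-+ {q} _ _) (cong (_+ ∑[ j < q ] (b₀ * (r * (x j * e j)))) (∑-distrib-+ {q} _ _)) ⟩
    ∑[ j < q ] (a₀ * (x j * e j)) + ∑[ j < q ] (b₀ * (suc r * (y j * e j))) + ∑[ j < q ] (b₀ * (r * (x j * e j)))
      ≡⟨ cong₂ _+_ (cong₂ _+_ (sym (*-distribˡ-sum {q} a₀ _)) (sym (*-distribˡ-sum {q} b₀ _))) (sym (*-distribˡ-sum {q} b₀ _)) ⟩
    a₀ * M r + b₀ * ∑[ j < q ] (suc r * (y j * e j)) + b₀ * ∑[ j < q ] (r * (x j * e j))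
      ≡⟨ cong₂ (λ s t → a₀ * M r + b₀ * s + b₀ * t) (sym (*-distribˡ-sum {q} (suc r) _)) (sym (*-distribˡ-sum {q} r _)) ⟩
    a₀ * M r + b₀ * (suc r * M (suc r)) + b₀ * (r * M r) ∎
    where
    open ≡-Reasoning
    a₀ = a zero
    b₀ = b zero
    M = binomialMoment q d (a ∘ suc) (b ∘ suc)
    e = linProd d (a ∘ suc) (b ∘ suc) ∘ toℕ
    x = λ (j : Fin q) → toℕ j C r
    y = λ (j : Fin q) → toℕ j C suc r
    expand : ∀ x j a₀ b₀ e → x * ((a₀ + j * b₀) * e) ≡ a₀ * (x * e) + b₀ * (j * x * e)
    expand = solve-∀
    split : ∀ a₀ b₀ x y e r → a₀ * (x * e) + b₀ * ((suc r * y + r * x) * e) ≡ a₀ * (x * e) + b₀ * (suc r * (y * e)) + b₀ * (r * (x * e))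
    split = solve-∀

  -- Congruences modulo p

  module Modular (p : ℕ) .{{_ : NonZero p}} where

    infix 4 _≡ₚ_
    _≡ₚ_ : ℕ → ℕ → Set
    a ≡ₚ b = a % p ≡ b % p

    _≟ₚ_ : ∀ a b → Dec (a ≡ₚ b)
    a ≟ₚ b = a % p ℕ.≟ b % p

    0%p≡0 : 0 % p ≡ 0
    0%p≡0 = m*n%n≡0 0 p

    +-congₚ : ∀ {a a′ b b′} → a ≡ₚ a′ → b ≡ₚ b′ → a + b ≡ₚ a′ + b′
    +-congₚ {a} {a′} {b} {b′} a≡a′ b≡b′ =
      trans (%-distribˡ-+ a b p) (trans (cong₂ (λ x y → (x + y) % p) a≡a′ b≡b′) (sym (%-distribˡ-+ a′ b′ p)))

    *-congₚ : ∀ {a a′ b b′} → a ≡ₚ a′ → b ≡ₚ b′ → a * b ≡ₚ a′ * b′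
    *-congₚ {a} {a′} {b} {b′} a≡a′ b≡b′ =
      trans (%-distribˡ-* a b p) (trans (cong₂ (λ x y → (x * y) % p) a≡a′ b≡b′) (sym (%-distribˡ-* a′ b′ p)))

    *-congˡₚ : ∀ c {b b′} → b ≡ₚ b′ → c * b ≡ₚ c * b′
    *-congˡₚ c = *-congₚ {c} refl

    %≡ₚ : ∀ a → a % p ≡ₚ a
    %≡ₚ a = m%n%n≡m%n a p

    p*≡ₚ0 : ∀ a → p * a ≡ₚ 0
    p*≡ₚ0 a = trans (cong (_% p) (*-comm p a)) (trans (m*n%n≡0 a p) (sym 0%p≡0))

    ∣⇒≡ₚ0 : ∀ {a} → p ∣ a → a ≡ₚ 0
    ∣⇒≡ₚ0 {a} p∣a = trans (n∣m⇒m%n≡0 a p p∣a) (sym 0%p≡0)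

    ≡ₚ0⇒∣ : ∀ {a} → a ≡ₚ 0 → p ∣ a
    ≡ₚ0⇒∣ {a} a≡0 = m%n≡0⇒n∣m a p (trans a≡0 0%p≡0)

    -- a + (p ∸ 1) * b represents a - b modulo p.
    +[p∸1]*≡ₚ0⇒≡ₚ : ∀ a b → a + (p ∸ 1) * b ≡ₚ 0 → a ≡ₚ b
    +[p∸1]*≡ₚ0⇒≡ₚ a b eq = begin
      a % p                     ≡⟨ [m+kn]%n≡m%n a b p ⟨
      (a + b * p) % p           ≡⟨ cong (λ x → (a + b * x) % p) (suc-pred p) ⟨
      (a + b * suc (p ∸ 1)) % p ≡⟨ cong (_% p) (regroup a b (p ∸ 1)) ⟩
      (a + (p ∸ 1) * b + b) % p ≡⟨ +-congₚ {a + (p ∸ 1) * b} {0} {b} eq refl ⟩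
      b % p                     ∎
      where
      open ≡-Reasoning
      regroup : ∀ a b q → a + b * suc q ≡ a + q * b + b
      regroup = solve-∀

    ≡ₚ⇒+[p∸1]*≡ₚ0 : ∀ a b → a ≡ₚ b → a + (p ∸ 1) * b ≡ₚ 0
    ≡ₚ⇒+[p∸1]*≡ₚ0 a b a≡b = begin
      (a + (p ∸ 1) * b) % p ≡⟨ +-congₚ {a} {b} a≡b refl ⟩
      (b + (p ∸ 1) * b) % p ≡⟨⟩
      (1 + (p ∸ 1)) * b % p ≡⟨ cong (λ x → x * b % p) (suc-pred p) ⟩
      p * b % p             ≡⟨ p*≡ₚ0 b ⟩
      0 % p                 ∎
      where open ≡-Reasoning

    toℕ-≡ₚ⇒≡ : ∀ {a b : Fin p} → toℕ a ≡ₚ toℕ b → a ≡ b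
    toℕ-≡ₚ⇒≡ {a} {b} a≡b = Finₚ.toℕ-injective (begin
      toℕ a     ≡⟨ m<n⇒m%n≡m (Finₚ.toℕ<n a) ⟨
      toℕ a % p ≡⟨ a≡b ⟩
      toℕ b % p ≡⟨ m<n⇒m%n≡m (Finₚ.toℕ<n b) ⟩
      toℕ b     ∎)
      where open ≡-Reasoning

    ∑-congₚ : ∀ {m} {f g : Fin m → ℕ} → (∀ i → f i ≡ₚ g i) → sum f ≡ₚ sum g
    ∑-congₚ {zero}  f≡g = refl
    ∑-congₚ {suc m} f≡g = +-congₚ (f≡g zero) (∑-congₚ (f≡g ∘ suc))

    ∏-congₚ : ∀ {m} {f g : Fin m → ℕ} → (∀ i → f i ≡ₚ g i) → ∏ f ≡ₚ ∏ g
    ∏-congₚ {zero}  f≡g = refl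
    ∏-congₚ {suc m} f≡g = *-congₚ (f≡g zero) (∏-congₚ (f≡g ∘ suc))

    ∏-zeroₚ : ∀ {m} (f : Fin m → ℕ) i → f i ≡ₚ 0 → ∏ f ≡ₚ 0
    ∏-zeroₚ f zero    fi≡0 = *-congₚ {f zero} {0} fi≡0 refl
    ∏-zeroₚ f (suc i) fi≡0 = trans (*-congˡₚ (f zero) (∏-zeroₚ (f ∘ suc) i fi≡0)) (cong (_% p) (*-zeroʳ (f zero)))

    sumFunℕ-congₚ : ∀ k {m} {f g : (Fin k → Fin m) → ℕ} → (∀ z → f z ≡ₚ g z) → sumFunℕ k m f ≡ₚ sumFunℕ k m g
    sumFunℕ-congₚ zero    f≡g = f≡g _
    sumFunℕ-congₚ (suc k) f≡g = ∑-congₚ λ a → sumFunℕ-congₚ k (f≡g ∘ (a ◂_))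

    module _ (isPrime : Prime p) where

      1<p : 1 < p
      1<p = ℕ.nonTrivial⇒n>1 p {{prime⇒nonTrivial isPrime}}

      p∤n! : ∀ {n} → n < p → p ∤ n !
      p∤n! {zero}  n<p p∣1 = contradiction (∣⇒≤ p∣1) (<⇒≱ 1<p)
      p∤n! {suc n} n<p p∣n! with euclidsLemma (suc n) (n !) isPrime p∣n!
      ... | inj₁ p∣1+n = contradiction (∣⇒≤ p∣1+n) (<⇒≱ n<p)
      ... | inj₂ p∣n!′ = p∤n! (<⇒≤ n<p) p∣n!′

      p∣pCk : ∀ {k} → 0 < k → k < p → p ∣ p C k
      p∣pCk {suc k} _ k<p with euclidsLemma (suc k) (p C suc k) isPrime p∣[1+k]*pC[1+k]
        where
        p∣[1+k]*pC[1+k] : p ∣ suc k * (p C suc k)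
        p∣[1+k]*pC[1+k] = divides ((p ∸ 1) C k) (begin
          suc k * (p C suc k)           ≡⟨ cong (λ n → suc k * (n C suc k)) (suc-pred p) ⟨
          suc k * (suc (p ∸ 1) C suc k) ≡⟨ [1+k]*[1+n]C[1+k]≡[1+n]*nCk (p ∸ 1) k ⟩
          suc (p ∸ 1) * ((p ∸ 1) C k)   ≡⟨ cong (_* ((p ∸ 1) C k)) (suc-pred p) ⟩
          p * ((p ∸ 1) C k)             ≡⟨ *-comm p _ ⟩
          ((p ∸ 1) C k) * p             ∎)
          where open ≡-Reasoning
      ... | inj₁ p∣1+k = contradiction (∣⇒≤ p∣1+k) (<⇒≱ k<p)
      ... | inj₂ p∣pCk′ = p∣pCk′

      binomialMoment≡ₚ0 : ∀ d (a b : Fin d → ℕ) r → suc (r + d) < p → binomialMoment p d a b r ≡ₚ 0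
      binomialMoment≡ₚ0 zero    a b r lt =
        ∣⇒≡ₚ0 (subst (p ∣_) (sym (binomialMoment-zero p a b r)) (p∣pCk (s≤s z≤n) (subst (λ x → suc x < p) (+-identityʳ r) lt)))
      binomialMoment≡ₚ0 (suc d) a b r lt = begin
        binomialMoment p (suc d) a b r % p
          ≡⟨ cong (_% p) (binomialMoment-suc p d a b r) ⟩
        (a₀ * M r + b₀ * (suc r * M (suc r)) + b₀ * (r * M r)) % p
          ≡⟨ +-congₚ (+-congₚ (*-congˡₚ a₀ Mr≡0) (*-congˡₚ b₀ (*-congˡₚ (suc r) M[1+r]≡0))) (*-congˡₚ b₀ (*-congˡₚ r Mr≡0)) ⟩
        (a₀ * 0 + b₀ * (suc r * 0) + b₀ * (r * 0)) % p
          ≡⟨ cong (_% p) (vanish a₀ b₀ r) ⟩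
        0 % p ∎
        where
        open ≡-Reasoning
        a₀ = a zero
        b₀ = b zero
        M = binomialMoment p d (a ∘ suc) (b ∘ suc)
        Mr≡0 : M r ≡ₚ 0
        Mr≡0 = binomialMoment≡ₚ0 d (a ∘ suc) (b ∘ suc) r (<-trans (n<1+n _) (subst (λ x → suc x < p) (+-suc r d) lt))
        M[1+r]≡0 : M (suc r) ≡ₚ 0
        M[1+r]≡0 = binomialMoment≡ₚ0 d (a ∘ suc) (b ∘ suc) (suc r) (subst (λ x → suc x < p) (+-suc r d) lt)
        vanish : ∀ a b r → a * 0 + b * (suc r * 0) + b * (r * 0) ≡ 0
        vanish = solve-∀

      r!*binomialMoment≡ₚ : ∀ d (a b : Fin d → ℕ) r → suc (r + d) ≡ p →
        r ! * binomialMoment p d a b r ≡ₚ (r + d) ! * ∏ b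
      r!*binomialMoment≡ₚ zero    a b r eq = cong (_% p) (begin
        r ! * binomialMoment p 0 a b r ≡⟨ cong (r ! *_) (binomialMoment-zero p a b r) ⟩
        r ! * (p C suc r)              ≡⟨ cong (λ x → r ! * (p C x)) (trans (cong suc (sym (+-identityʳ r))) eq) ⟩
        r ! * (p C p)                  ≡⟨ cong (r ! *_) (nCn≡1 p) ⟩
        r ! * 1                        ≡⟨ cong (λ x → x ! * 1) (+-identityʳ r) ⟨
        (r + 0) ! * 1                  ∎)
        where open ≡-Reasoning
      r!*binomialMoment≡ₚ (suc d) a b r eq = begin
        r ! * binomialMoment p (suc d) a b r % p
          ≡⟨ cong (λ x → r ! * x % p) (binomialMoment-suc p d a b r) ⟩
        r ! * (a₀ * M r + b₀ * (suc r * M (suc r)) + b₀ * (r * M r)) % p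
          ≡⟨ *-congˡₚ (r !) (+-congₚ (+-congₚ (*-congˡₚ a₀ Mr≡0) refl) (*-congˡₚ b₀ (*-congˡₚ r Mr≡0))) ⟩
        r ! * (a₀ * 0 + b₀ * (suc r * M (suc r)) + b₀ * (r * 0)) % p
          ≡⟨ cong (_% p) (regroup (r !) a₀ b₀ (suc r) (M (suc r)) r) ⟩
        b₀ * ((suc r) ! * M (suc r)) % p
          ≡⟨ *-congˡₚ b₀ (r!*binomialMoment≡ₚ d (a ∘ suc) (b ∘ suc) (suc r) (trans (cong suc (sym (+-suc r d))) eq)) ⟩
        b₀ * ((suc r + d) ! * ∏ (b ∘ suc)) % p
          ≡⟨ cong (λ x → b₀ * (x ! * ∏ (b ∘ suc)) % p) (+-suc r d) ⟨
        b₀ * ((r + suc d) ! * ∏ (b ∘ suc)) % p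
          ≡⟨ cong (_% p) (x∙yz≈y∙xz b₀ ((r + suc d) !) (∏ (b ∘ suc))) ⟩
        (r + suc d) ! * (b₀ * ∏ (b ∘ suc)) % p ∎
        where
        open ≡-Reasoning
        a₀ = a zero
        b₀ = b zero
        M = binomialMoment p d (a ∘ suc) (b ∘ suc)
        Mr≡0 : M r ≡ₚ 0
        Mr≡0 = binomialMoment≡ₚ0 d (a ∘ suc) (b ∘ suc) r (subst (_< p) (+-suc r d) (≤-reflexive eq))
        regroup : ∀ f a b s x r → f * (a * 0 + b * (s * x) + b * (r * 0)) ≡ b * (s * f * x)
        regroup = solve-∀

      ∑-linProd≡ₚ : ∀ d (a b : Fin d → ℕ) → suc d ≡ p → ∑[ j < p ] linProd d a b (toℕ j) ≡ₚ d ! * ∏ b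
      ∑-linProd≡ₚ d a b eq = trans (cong (_% p) (sym (trans (+-identityʳ _) (sum-cong-≗ {p} λ j → +-identityʳ _))))
        (r!*binomialMoment≡ₚ d a b 0 eq)

  -- Lines and overwritten coordinates in 𝔽ₚⁿ

  toℕ-mod : ∀ x {p} .{{_ : NonZero p}} → toℕ (x mod p) ≡ x % p
  toℕ-mod x {p} = Finₚ.toℕ-fromℕ< (m%n<n x p)

  line : ∀ {p} .{{_ : NonZero p}} {n} → Γ p n → Γ p n → ℕ → Γ p n
  line {p} u v j = addΓ p u (scaleΓ p j v)

  module _ {p : ℕ} .{{_ : NonZero p}} where
    open Modular p

    toℕ-line : ∀ {n} (u v : Γ p n) j i → toℕ (line u v j i) ≡ₚ toℕ (u i) + j * toℕ (v i)
    toℕ-line u v j i = begin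
      toℕ (line u v j i) % p                     ≡⟨ cong (_% p) (toℕ-mod _) ⟩
      (toℕ (u i) + toℕ (scaleΓ p j v i)) % p % p ≡⟨ %≡ₚ _ ⟩
      (toℕ (u i) + toℕ (scaleΓ p j v i)) % p     ≡⟨ +-congₚ {toℕ (u i)} refl (trans (cong (_% p) (toℕ-mod _)) (%≡ₚ _)) ⟩
      (toℕ (u i) + j * toℕ (v i)) % p            ∎
      where open ≡-Reasoning

  module _ {m : ℕ} where

    updateAt-cong : ∀ {n} {v w : Fin n → Fin m} → (∀ i → v i ≡ w i) → ∀ c a i → updateAt v c (const a) i ≡ updateAt w c (const a) i
    updateAt-cong v≗w c a i with i ≟ c
    ... | yes refl = trans (updateAt-updates i _) (sym (updateAt-updates i _))
    ... | no i≢c   = trans (updateAt-minimal i c _ i≢c) (trans (v≗w i) (sym (updateAt-minimal i c _ i≢c)))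

    updateAt-extensional : ∀ {n} {h : (Fin n → Fin m) → ℕ} → Extensional h → ∀ c a → Extensional (λ v → h (updateAt v c (const a)))
    updateAt-extensional h-ext c a v≗w = h-ext (updateAt-cong v≗w c a)

    sumFunℕ-updateAt : ∀ n (h : (Fin n → Fin m) → ℕ) → Extensional h → ∀ c a →
      sumFunℕ n m (λ v → h (updateAt v c (const a))) ≤ m * sumFunℕ n m h
    sumFunℕ-updateAt (suc n) h h-ext zero a = begin
      ∑[ b < m ] sumFunℕ n m (λ g → h (updateAt (b ◂ g) zero (const a)))
        ≡⟨ sum-cong-≗ {m} (λ b → sumFunℕ-cong n λ g → h-ext λ { zero → refl ; (suc i) → refl }) ⟩
      ∑[ b < m ] sumFunℕ n m (λ g → h (a ◂ g))
        ≡⟨ ∑-const m _ ⟩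
      m * sumFunℕ n m (λ g → h (a ◂ g))
        ≤⟨ *-monoʳ-≤ m (term≤∑ (λ b → sumFunℕ n m (λ g → h (b ◂ g))) a) ⟩
      m * sumFunℕ (suc n) m h ∎
      where open ≤-Reasoning
    sumFunℕ-updateAt (suc n) h h-ext (suc c) a = begin
      ∑[ b < m ] sumFunℕ n m (λ g → h (updateAt (b ◂ g) (suc c) (const a)))
        ≡⟨ sum-cong-≗ {m} (λ b → sumFunℕ-cong n λ g → h-ext λ { zero → refl ; (suc i) → refl }) ⟩
      ∑[ b < m ] sumFunℕ n m (λ g → h (b ◂ updateAt g c (const a)))
        ≤⟨ ∑-mono-≤ (λ b → sumFunℕ-updateAt n (h ∘ (b ◂_)) (◂-extensional h-ext b) c a) ⟩
      ∑[ b < m ] (m * sumFunℕ n m (λ g → h (b ◂ g)))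
        ≡⟨ *-distribˡ-sum m (λ b → sumFunℕ n m (λ g → h (b ◂ g))) ⟨
      m * sumFunℕ (suc n) m h ∎
      where open ≤-Reasoning

    overwrite : ∀ {n d} → (Fin d → Fin n) → (Fin d → Fin m) → (Fin n → Fin m) → (Fin n → Fin m)
    overwrite {d = zero}  c a v = v
    overwrite {d = suc d} c a v = updateAt (overwrite (c ∘ suc) (a ∘ suc) v) (c zero) (const (a zero))

    overwrite-outside : ∀ {n d} (c : Fin d → Fin n) a v i → (∀ k → i ≢ c k) → overwrite c a v i ≡ v i
    overwrite-outside {d = zero}  c a v i i∉c = refl
    overwrite-outside {d = suc d} c a v i i∉c =
      trans (updateAt-minimal i (c zero) _ (i∉c zero)) (overwrite-outside (c ∘ suc) (a ∘ suc) v i (i∉c ∘ suc))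

    overwrite-inside : ∀ {n d} (c : Fin d → Fin n) a v → (∀ {k k′} → c k ≡ c k′ → k ≡ k′) → ∀ k → overwrite c a v (c k) ≡ a k
    overwrite-inside {d = suc d} c a v c-inj zero    = updateAt-updates (c zero) _
    overwrite-inside {d = suc d} c a v c-inj (suc k) =
      trans (updateAt-minimal (c (suc k)) (c zero) _ (λ eq → Finₚ.0≢1+n (sym (c-inj eq))))
            (overwrite-inside (c ∘ suc) (a ∘ suc) v (Finₚ.suc-injective ∘ c-inj) k)

    sumFunℕ-overwrite : ∀ n d (h : (Fin n → Fin m) → ℕ) → Extensional h → ∀ c a →
      sumFunℕ n m (λ v → h (overwrite {n} {d} c a v)) ≤ m ^ d * sumFunℕ n m h
    sumFunℕ-overwrite n zero    h h-ext c a = ≤-reflexive (sym (+-identityʳ _))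
    sumFunℕ-overwrite n (suc d) h h-ext c a = begin
      sumFunℕ n m (λ v → h (updateAt (overwrite (c ∘ suc) (a ∘ suc) v) (c zero) (const (a zero))))
        ≤⟨ sumFunℕ-overwrite n d _ (updateAt-extensional h-ext (c zero) (a zero)) (c ∘ suc) (a ∘ suc) ⟩
      m ^ d * sumFunℕ n m (λ w → h (updateAt w (c zero) (const (a zero))))
        ≤⟨ *-monoʳ-≤ (m ^ d) (sumFunℕ-updateAt n h h-ext (c zero) (a zero)) ⟩
      m ^ d * (m * sumFunℕ n m h)
        ≡⟨ trans (sym (*-assoc (m ^ d) m _)) (cong (_* sumFunℕ n m h) (*-comm (m ^ d) m)) ⟩
      m ^ suc d * sumFunℕ n m h ∎
      where open ≤-Reasoning

  -- Block-multilinear forms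

  funToFin-cong : ∀ {k m} {f g : Fin k → Fin m} → (∀ i → f i ≡ g i) → funToFin f ≡ funToFin g
  funToFin-cong {zero}  f≗g = refl
  funToFin-cong {suc k} f≗g = cong₂ combine (f≗g zero) (funToFin-cong (f≗g ∘ suc))

  funToFin-injective : ∀ {k m} {f g : Fin k → Fin m} → funToFin f ≡ funToFin g → ∀ i → f i ≡ g i
  funToFin-injective {f = f} {g} eq i =
    trans (sym (Finₚ.finToFun-funToFin f i)) (trans (cong (λ x → finToFun x i) eq) (Finₚ.finToFun-funToFin g i))

  finToFun-injective : ∀ {k m} {i j : Fin (m ^ k)} → (∀ t → finToFun {m} {k} i t ≡ finToFun j t) → i ≡ j
  finToFun-injective {k} {m} {i} {j} eq =
    trans (sym (Finₚ.funToFin-finToFin {k} {m} i)) (trans (funToFin-cong eq) (Finₚ.funToFin-finToFin {k} {m} j))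

  module BlockForms (p : ℕ) .{{_ : NonZero p}} (n d m : ℕ) (pos : Fin d → Fin m → Fin n)
    (pos-injective : ∀ {k i k′ i′} → pos k i ≡ pos k′ i′ → k ≡ k′ × i ≡ i′) where

    open Modular p

    N : ℕ
    N = m ^ d

    index : Fin N → Fin d → Fin m
    index = finToFun

    monomial : Fin N → Γ p n → ℕ
    monomial t w = ∏ (λ k → toℕ (w (pos k (index t k))))

    blockForm : (Fin N → ℕ) → Γ p n → ℕ
    blockForm T w = ∑[ t < N ] (T t * monomial t w)

    blockForm-cong : ∀ T {w w′ : Γ p n} → (∀ i → w i ≡ w′ i) → blockForm T w ≡ blockForm T w′
    blockForm-cong T w≗w′ = sum-cong-≗ {N} λ t → cong (T t *_) (∏-cong {d} λ k → cong toℕ (w≗w′ _))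

    blockForm-linear : ∀ T₁ T₂ q w → blockForm (λ t → T₁ t + q * T₂ t) w ≡ blockForm T₁ w + q * blockForm T₂ w
    blockForm-linear T₁ T₂ q w = begin
      ∑[ t < N ] ((T₁ t + q * T₂ t) * monomial t w)                ≡⟨ sum-cong-≗ {N} (λ t → distrib (T₁ t) (T₂ t) q (monomial t w)) ⟩
      ∑[ t < N ] (T₁ t * monomial t w + q * (T₂ t * monomial t w)) ≡⟨ ∑-distrib-+ {N} _ _ ⟩
      blockForm T₁ w + ∑[ t < N ] (q * (T₂ t * monomial t w))      ≡⟨ cong (blockForm T₁ w +_) (*-distribˡ-sum {N} q _) ⟨
      blockForm T₁ w + q * blockForm T₂ w                          ∎
      where
      open ≡-Reasoning
      distrib : ∀ a b q x → (a + q * b) * x ≡ a * x + q * (b * x)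
      distrib = solve-∀

    ∑-line-blockForm : Prime p → suc d ≡ p → ∀ T u v → ∑[ j < p ] blockForm T (line u v (toℕ j)) ≡ₚ d ! * blockForm T v
    ∑-line-blockForm isPrime d+1≡p T u v = begin
      ∑[ j < p ] blockForm T (line u v (toℕ j)) % p
        ≡⟨ ∑-congₚ {p} (λ j → ∑-congₚ {N} λ t → *-congˡₚ (T t) (∏-congₚ {d} λ k → toℕ-line u v (toℕ j) _)) ⟩
      ∑[ j < p ] ∑[ t < N ] (T t * linProd d (a t) (b t) (toℕ j)) % p
        ≡⟨ cong (_% p) (trans (∑-comm {p} {N} _) (sum-cong-≗ {N} λ t → sym (*-distribˡ-sum {p} (T t) _))) ⟩
      ∑[ t < N ] (T t * ∑[ j < p ] linProd d (a t) (b t) (toℕ j)) % p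
        ≡⟨ ∑-congₚ {N} (λ t → *-congˡₚ (T t) (∑-linProd≡ₚ isPrime d (a t) (b t) d+1≡p)) ⟩
      ∑[ t < N ] (T t * (d ! * ∏ (b t))) % p
        ≡⟨ cong (_% p) (trans (sum-cong-≗ {N} λ t → x∙yz≈y∙xz (T t) (d !) (∏ (b t))) (sym (*-distribˡ-sum {N} (d !) _))) ⟩
      d ! * blockForm T v % p ∎
      where
      open ≡-Reasoning
      a b : Fin N → Fin d → ℕ
      a t k = toℕ (u (pos k (index t k)))
      b t k = toℕ (v (pos k (index t k)))

    module _ (1<p : 1 < p) where

      bit : Fin 2 → Fin p
      bit zero       = fromℕ< (<-trans ℕ.z<s 1<p)
      bit (suc zero) = fromℕ< 1<p

      toℕ-bit : ∀ b → toℕ (bit b) ≡ toℕ b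
      toℕ-bit zero       = Finₚ.toℕ-fromℕ< _
      toℕ-bit (suc zero) = Finₚ.toℕ-fromℕ< _

      -- weight zero ≡ -1 (mod p): summing against ∏ weight takes iterated differences in the
      -- variables of one monomial, which kills every other monomial.
      weight : Fin 2 → ℕ
      weight zero       = p ∸ 1
      weight (suc zero) = 1

      cell : Fin N → Fin d → Fin n
      cell t k = pos k (index t k)

      cell-injective : ∀ t {k k′} → cell t k ≡ cell t k′ → k ≡ k′
      cell-injective t eq = proj₁ (pos-injective eq)

      modify : Fin N → (Fin d → Fin 2) → Γ p n → Γ p n
      modify t₀ z = overwrite (cell t₀) (bit ∘ z)

      restrictedMonomial : Fin N → Γ p n → Fin N → Fin d → Fin 2 → ℕ
      restrictedMonomial t₀ v t k b = if ⌊ index t k ≟ index t₀ k ⌋ then toℕ b else toℕ (v (cell t k))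

      monomial-modify : ∀ t₀ z v t → monomial t (modify t₀ z v) ≡ ∏ (λ k → restrictedMonomial t₀ v t k (z k))
      monomial-modify t₀ z v t = ∏-cong {d} coordinate
        where
        coordinate : ∀ k → toℕ (modify t₀ z v (cell t k)) ≡ restrictedMonomial t₀ v t k (z k)
        coordinate k with index t k ≟ index t₀ k
        ... | yes eq = trans (cong (λ i → toℕ (modify t₀ z v (pos k i))) eq)
                             (trans (cong toℕ (overwrite-inside (cell t₀) (bit ∘ z) v (cell-injective t₀) k)) (toℕ-bit (z k)))
        ... | no neq = cong toℕ (overwrite-outside (cell t₀) (bit ∘ z) v (cell t k) outside)
          where
          outside : ∀ k′ → cell t k ≢ cell t₀ k′
          outside k′ eq with pos-injective eq
          ... | refl , eq′ = neq eq′

      differenceFactor : Fin N → Γ p n → Fin N → Fin d → ℕ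
      differenceFactor t₀ v t k = ∑[ b < 2 ] (weight b * restrictedMonomial t₀ v t k b)

      differenceFactor-≡ : ∀ t₀ v t k → index t k ≡ index t₀ k → differenceFactor t₀ v t k ≡ 1
      differenceFactor-≡ t₀ v t k eq with index t k ≟ index t₀ k
      ... | yes _  = cong (_+ 1) (*-zeroʳ (p ∸ 1))
      ... | no neq = contradiction eq neq

      differenceFactor-≢ : ∀ t₀ v t k → index t k ≢ index t₀ k → differenceFactor t₀ v t k ≡ₚ 0
      differenceFactor-≢ t₀ v t k neq with index t k ≟ index t₀ k
      ... | yes eq = contradiction eq neq
      ... | no _   = trans (cong (_% p) (trans (collect (p ∸ 1) x) (cong (_* x) (m∸n+n≡m (<⇒≤ 1<p))))) (p*≡ₚ0 x)
        where
        x = toℕ (v (cell t k))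
        collect : ∀ q x → q * x + (1 * x + 0) ≡ (q + 1) * x
        collect = solve-∀

      ∏-differenceFactor≡ₚkronecker : ∀ t₀ v t → ∏ (differenceFactor t₀ v t) ≡ₚ kronecker t₀ t
      ∏-differenceFactor≡ₚkronecker t₀ v t with t ≟ t₀
      ... | yes refl = cong (_% p) (begin
        ∏ (differenceFactor t v t) ≡⟨ ∏-cong {d} (λ k → differenceFactor-≡ t v t k refl) ⟩
        ∏ {d} (λ _ → 1)            ≡⟨ ∏-const d 1 ⟩
        1 ^ d                      ≡⟨ ^-zeroˡ d ⟩
        1                          ≡⟨ kronecker-refl t ⟨
        kronecker t t              ∎)
        where open ≡-Reasoning
      ... | no t≢t₀ with Finₚ.¬∀⟶∃¬ d _ (λ k → index t k ≟ index t₀ k) (t≢t₀ ∘ finToFun-injective)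
      ...   | k , differ = trans (∏-zeroₚ _ k (differenceFactor-≢ t₀ v t k differ))
                                 (cong (_% p) (sym (kronecker-≢ (t≢t₀ ∘ sym))))

      ∑-moebius : ∀ T t₀ v → sumFunℕ d 2 (λ z → ∏ (weight ∘ z) * blockForm T (modify t₀ z v)) ≡ₚ T t₀
      ∑-moebius T t₀ v = begin
        sumFunℕ d 2 (λ z → ∏ (weight ∘ z) * blockForm T (modify t₀ z v)) % p
          ≡⟨ cong (_% p) (sumFunℕ-cong d expand) ⟩
        sumFunℕ d 2 (λ z → ∑[ t < N ] (T t * ∏ (λ k → weight (z k) * R t k (z k)))) % p
          ≡⟨ cong (_% p) (sumFunℕ-∑-comm d N _) ⟩
        ∑[ t < N ] sumFunℕ d 2 (λ z → T t * ∏ (λ k → weight (z k) * R t k (z k))) % p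
          ≡⟨ cong (_% p) (sum-cong-≗ {N} λ t → trans (sym (sumFunℕ-*ˡ d (T t) _)) (cong (T t *_) (sumFunℕ-∏ d λ k b → weight b * R t k b))) ⟩
        ∑[ t < N ] (T t * ∏ (differenceFactor t₀ v t)) % p
          ≡⟨ ∑-congₚ {N} (λ t → *-congˡₚ (T t) (∏-differenceFactor≡ₚkronecker t₀ v t)) ⟩
        ∑[ t < N ] (T t * kronecker t₀ t) % p
          ≡⟨ cong (_% p) (trans (sum-cong-≗ {N} λ t → *-comm (T t) _) (∑-kronecker t₀ T)) ⟩
        T t₀ % p ∎
        where
        open ≡-Reasoning
        R = restrictedMonomial t₀ v
        expand : ∀ z → ∏ (weight ∘ z) * blockForm T (modify t₀ z v) ≡ ∑[ t < N ] (T t * ∏ (λ k → weight (z k) * R t k (z k)))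
        expand z = trans (*-distribˡ-sum {N} (∏ (weight ∘ z)) _) (sum-cong-≗ {N} λ t → begin
          ∏ (weight ∘ z) * (T t * monomial t (modify t₀ z v)) ≡⟨ cong (λ x → ∏ (weight ∘ z) * (T t * x)) (monomial-modify t₀ z v t) ⟩
          ∏ (weight ∘ z) * (T t * ∏ (λ k → R t k (z k)))      ≡⟨ x∙yz≈y∙xz (∏ (weight ∘ z)) (T t) _ ⟩
          T t * (∏ (weight ∘ z) * ∏ (λ k → R t k (z k)))      ≡⟨ cong (T t *_) (∏-distrib-* {d} (weight ∘ z) (λ k → R t k (z k))) ⟨
          T t * ∏ (λ k → weight (z k) * R t k (z k))          ∎)

      nonvanishing : (Fin N → ℕ) → Γ p n → ℕ
      nonvanishing T w = if ⌊ blockForm T w ≟ₚ 0 ⌋ then 0 else 1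

      nonvanishing-extensional : ∀ T → Extensional (nonvanishing T)
      nonvanishing-extensional T w≗w′ = cong (λ x → if ⌊ x ≟ₚ 0 ⌋ then 0 else 1) (blockForm-cong T w≗w′)

      %p*nonvanishing : ∀ T w → blockForm T w % p * nonvanishing T w ≡ blockForm T w % p
      %p*nonvanishing T w with blockForm T w ≟ₚ 0
      ... | yes F≡0 = trans (*-zeroʳ (blockForm T w % p)) (sym (trans F≡0 0%p≡0))
      ... | no _    = *-identityʳ _

      some-modify-nonvanishing : ∀ T t₀ → ¬ (T t₀ ≡ₚ 0) → ∀ v → 1 ≤ sumFunℕ d 2 (λ z → nonvanishing T (modify t₀ z v))
      some-modify-nonvanishing T t₀ Tt₀≢0 v with sumFunℕ d 2 (λ z → nonvanishing T (modify t₀ z v)) in none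
      ... | suc _ = s≤s z≤n
      ... | zero  = contradiction (begin
        T t₀ % p                                ≡⟨ ∑-moebius T t₀ v ⟨
        sumFunℕ d 2 (λ z → W z * F z) % p       ≡⟨ sumFunℕ-congₚ d (λ z → *-congˡₚ (W z) (sym (%≡ₚ (F z)))) ⟩
        sumFunℕ d 2 (λ z → W z * (F z % p)) % p ≡⟨ cong (_% p) (sumFunℕ-cong d λ z → cong (W z *_) (sym (%p*nonvanishing T (modify t₀ z v)))) ⟩
        sumFunℕ d 2 (λ z → W z * (F z % p * nonvanishing T (modify t₀ z v))) % p
          ≡⟨ cong (_% p) (trans (sumFunℕ-cong d λ z → sym (*-assoc (W z) _ _)) (sumFunℕ-*≡0 d _ (λ z → W z * (F z % p)) none)) ⟩
        0 % p                                                   ∎) Tt₀≢0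
        where
        open ≡-Reasoning
        W = λ (z : Fin d → Fin 2) → ∏ (weight ∘ z)
        F = λ z → blockForm T (modify t₀ z v)

      blockForm-support : ∀ T t₀ → ¬ (T t₀ ≡ₚ 0) → p ^ n ≤ 2 ^ d * (p ^ d * sumFunℕ n p (nonvanishing T))
      blockForm-support T t₀ Tt₀≢0 = begin
        p ^ n                                                                  ≡⟨ trans (sym (*-identityʳ _)) (sym (sumFunℕ-const n 1)) ⟩
        sumFunℕ n p (λ _ → 1)                                                  ≤⟨ sumFunℕ-mono-≤ n (some-modify-nonvanishing T t₀ Tt₀≢0) ⟩
        sumFunℕ n p (λ v → sumFunℕ d 2 (λ z → nonvanishing T (modify t₀ z v))) ≡⟨ sumFunℕ-comm n p d 2 _ ⟩
        sumFunℕ d 2 (λ z → sumFunℕ n p (λ v → nonvanishing T (modify t₀ z v)))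
          ≤⟨ sumFunℕ-mono-≤ d (λ z → sumFunℕ-overwrite n d (nonvanishing T) (nonvanishing-extensional T) (cell t₀) (bit ∘ z)) ⟩
        sumFunℕ d 2 (λ _ → p ^ d * sumFunℕ n p (nonvanishing T)) ≡⟨ sumFunℕ-const d _ ⟩
        2 ^ d * (p ^ d * sumFunℕ n p (nonvanishing T))           ∎
        where open ≤-Reasoning

      evaluations : (S : List (Γ p n)) → Fin (p ^ N) → Fin (p ^ length S)
      evaluations S x = funToFin (λ s → blockForm (toℕ ∘ finToFun x) (lookup S s) mod p)

      vanishing-blockForm : (S : List (Γ p n)) → length S < N →
        ∃₂ λ T t₀ → ¬ (T t₀ ≡ₚ 0) × (∀ s → blockForm T (lookup S s) ≡ₚ 0)
      vanishing-blockForm S |S|<N with Finₚ.pigeonhole (^-monoʳ-< p 1<p |S|<N) (evaluations S)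
      ... | i , j , i<j , same = T , t₀ , Tt₀≢0 , vanishes
        where
        T₁ T₂ T : Fin N → ℕ
        T₁ = toℕ ∘ finToFun i
        T₂ = toℕ ∘ finToFun j
        T t = T₁ t + (p ∸ 1) * T₂ t
        differ = Finₚ.¬∀⟶∃¬ N _ (λ t → finToFun i t ≟ finToFun j t) (Finₚ.<⇒≢ i<j ∘ finToFun-injective)
        t₀ = proj₁ differ
        Tt₀≢0 : ¬ (T t₀ ≡ₚ 0)
        Tt₀≢0 = proj₂ differ ∘ toℕ-≡ₚ⇒≡ ∘ +[p∸1]*≡ₚ0⇒≡ₚ (T₁ t₀) (T₂ t₀)
        vanishes : ∀ s → blockForm T (lookup S s) ≡ₚ 0
        vanishes s = trans (cong (_% p) (blockForm-linear T₁ T₂ (p ∸ 1) (lookup S s))) (≡ₚ⇒+[p∸1]*≡ₚ0 _ _ (begin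
          blockForm T₁ (lookup S s) % p         ≡⟨ toℕ-mod _ ⟨
          toℕ (blockForm T₁ (lookup S s) mod p) ≡⟨ cong toℕ (funToFin-injective same s) ⟩
          toℕ (blockForm T₂ (lookup S s) mod p) ≡⟨ toℕ-mod _ ⟩
          blockForm T₂ (lookup S s) % p         ∎))
          where open ≡-Reasoning

  ℕtoℚ≡mkℚ : ∀ k → ℕtoℚ k ≡ mkℚ (ℤ.+ k) 0 (Coprime.sym (Coprime.1-coprimeTo k))
  ℕtoℚ≡mkℚ k = ℚₚ.normalize-coprime (Coprime.sym (Coprime.1-coprimeTo k))

  toℚᵘ-ℕtoℚ : ∀ k → ℚ.toℚᵘ (ℕtoℚ k) ℚᵘ.≃ ℚᵘ.mkℚᵘ (ℤ.+ k) 0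
  toℚᵘ-ℕtoℚ k rewrite ℕtoℚ≡mkℚ k = ℚᵘ.*≡* refl

  ℕtoℚ-+ : ∀ a b → ℕtoℚ (a + b) ≡ ℕtoℚ a ℚ.+ ℕtoℚ b
  ℕtoℚ-+ a b = ℚₚ.toℚᵘ-injective (begin-equality
    ℚ.toℚᵘ (ℕtoℚ (a + b))
      ≃⟨ toℚᵘ-ℕtoℚ (a + b) ⟩
    ℚᵘ.mkℚᵘ (ℤ.+ (a + b)) 0
      ≃⟨ ℚᵘ.*≡* (cong (ℤ._* ℤ.+ 1) (trans (ℤₚ.pos-+ a b) (cong₂ ℤ._+_ (sym (ℤₚ.*-identityʳ (ℤ.+ a))) (sym (ℤₚ.*-identityʳ (ℤ.+ b)))))) ⟩
    ℚᵘ.mkℚᵘ (ℤ.+ a) 0 ℚᵘ.+ ℚᵘ.mkℚᵘ (ℤ.+ b) 0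
      ≃⟨ ℚᵘₚ.+-cong (toℚᵘ-ℕtoℚ a) (toℚᵘ-ℕtoℚ b) ⟨
    ℚ.toℚᵘ (ℕtoℚ a) ℚᵘ.+ ℚ.toℚᵘ (ℕtoℚ b)
      ≃⟨ ℚₚ.toℚᵘ-homo-+ (ℕtoℚ a) (ℕtoℚ b) ⟨
    ℚ.toℚᵘ (ℕtoℚ a ℚ.+ ℕtoℚ b) ∎)
    where open ℚᵘₚ.≤-Reasoning

  ℕtoℚ-* : ∀ a b → ℕtoℚ (a * b) ≡ ℕtoℚ a ℚ.* ℕtoℚ b
  ℕtoℚ-* a b = ℚₚ.toℚᵘ-injective (begin-equality
    ℚ.toℚᵘ (ℕtoℚ (a * b))                    ≃⟨ toℚᵘ-ℕtoℚ (a * b) ⟩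
    ℚᵘ.mkℚᵘ (ℤ.+ (a * b)) 0                  ≃⟨ ℚᵘ.*≡* (cong (ℤ._* ℤ.+ 1) (ℤₚ.pos-* a b)) ⟩
    ℚᵘ.mkℚᵘ (ℤ.+ a) 0 ℚᵘ.* ℚᵘ.mkℚᵘ (ℤ.+ b) 0 ≃⟨ ℚᵘₚ.*-cong (toℚᵘ-ℕtoℚ a) (toℚᵘ-ℕtoℚ b) ⟨
    ℚ.toℚᵘ (ℕtoℚ a) ℚᵘ.* ℚ.toℚᵘ (ℕtoℚ b)     ≃⟨ ℚₚ.toℚᵘ-homo-* (ℕtoℚ a) (ℕtoℚ b) ⟨
    ℚ.toℚᵘ (ℕtoℚ a ℚ.* ℕtoℚ b)               ∎)
    where open ℚᵘₚ.≤-Reasoning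

  ℕtoℚ-mono-≤ : ∀ {a b} → a ≤ b → ℕtoℚ a ℚ.≤ ℕtoℚ b
  ℕtoℚ-mono-≤ {a} {b} a≤b rewrite ℕtoℚ≡mkℚ a | ℕtoℚ≡mkℚ b = *≤* (ℤₚ.*-monoʳ-≤-nonNeg (ℤ.+ 1) (ℤ.+≤+ a≤b))

  ℕtoℚ-cancel-≤ : ∀ {a b} → ℕtoℚ a ℚ.≤ ℕtoℚ b → a ≤ b
  ℕtoℚ-cancel-≤ {a} {b} a≤b rewrite ℕtoℚ≡mkℚ a | ℕtoℚ≡mkℚ b with a≤b
  ... | *≤* a*1≤b*1 = ℤₚ.drop‿+≤+ (subst₂ ℤ._≤_ (ℤₚ.*-identityʳ (ℤ.+ a)) (ℤₚ.*-identityʳ (ℤ.+ b)) a*1≤b*1)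

  ℕtoℚ-nonNeg : ∀ k → 0ℚ ℚ.≤ ℕtoℚ k
  ℕtoℚ-nonNeg k = ℕtoℚ-mono-≤ {0} {k} ℕ.z≤n

  ∣ℕtoℚ∣ : ∀ k → ℚ.∣ ℕtoℚ k ∣ ≡ ℕtoℚ k
  ∣ℕtoℚ∣ k = ℚₚ.0≤p⇒∣p∣≡p (ℕtoℚ-nonNeg k)

  ℕtoℚ-^ : ∀ k e → ℕtoℚ k ^ℚ e ≡ ℕtoℚ (k ℕ.^ e)
  ℕtoℚ-^ k zero    = refl
  ℕtoℚ-^ k (suc e) = trans (cong (ℕtoℚ k ℚ.*_) (ℕtoℚ-^ k e)) (sym (ℕtoℚ-* k _))

  inv*ℕtoℚ : ∀ k .{{_ : NonZero k}} → inv k ℚ.* ℕtoℚ k ≡ 1ℚ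
  inv*ℕtoℚ (suc k) = ℚₚ.toℚᵘ-injective (begin-equality
    ℚ.toℚᵘ (inv (suc k) ℚ.* ℕtoℚ (suc k))           ≃⟨ ℚₚ.toℚᵘ-homo-* (inv (suc k)) (ℕtoℚ (suc k)) ⟩
    ℚ.toℚᵘ (inv (suc k)) ℚᵘ.* ℚ.toℚᵘ (ℕtoℚ (suc k)) ≃⟨ ℚᵘₚ.*-cong toℚᵘ-inv (toℚᵘ-ℕtoℚ (suc k)) ⟩
    ℚᵘ.mkℚᵘ (ℤ.+ 1) k ℚᵘ.* ℚᵘ.mkℚᵘ (ℤ.+ suc k) 0    ≃⟨ ℚᵘ.*≡* (cong (λ x → ℤ.+ suc x) (arith k)) ⟩
    ℚᵘ.mkℚᵘ (ℤ.+ 1) 0                               ∎)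
    where
    open ℚᵘₚ.≤-Reasoning
    arith : ∀ k → (k + 0 * suc k) * 1 ≡ k * 1 + 0 * suc (k * 1)
    arith = solve-∀
    toℚᵘ-inv : ℚ.toℚᵘ (inv (suc k)) ℚᵘ.≃ ℚᵘ.mkℚᵘ (ℤ.+ 1) k
    toℚᵘ-inv rewrite ℚₚ.normalize-coprime {1} {k} (Coprime.1-coprimeTo (suc k)) = ℚᵘ.*≡* refl

  inv-pos : ∀ k .{{_ : NonZero k}} → 0ℚ ℚ.< inv k
  inv-pos (suc k) = ℚₚ.positive⁻¹ (inv (suc k)) {{ℚₚ.normalize-pos 1 (suc k)}}

  0≤inv : ∀ k → 0ℚ ℚ.≤ inv k
  0≤inv zero    = ℚₚ.≤-refl
  0≤inv (suc k) = ℚₚ.<⇒≤ (inv-pos (suc k))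

  *-monoˡ-≤-0≤ : ∀ {r x y} → 0ℚ ℚ.≤ r → x ℚ.≤ y → r ℚ.* x ℚ.≤ r ℚ.* y
  *-monoˡ-≤-0≤ {r} 0≤r = ℚₚ.*-monoˡ-≤-nonNeg r {{ℚ.nonNegative 0≤r}}

  *-monoʳ-≤-0≤ : ∀ {r x y} → 0ℚ ℚ.≤ r → x ℚ.≤ y → x ℚ.* r ℚ.≤ y ℚ.* r
  *-monoʳ-≤-0≤ {r} 0≤r = ℚₚ.*-monoʳ-≤-nonNeg r {{ℚ.nonNegative 0≤r}}

  0≤* : ∀ {x y} → 0ℚ ℚ.≤ x → 0ℚ ℚ.≤ y → 0ℚ ℚ.≤ x ℚ.* y
  0≤* {x} 0≤x 0≤y = ℚₚ.≤-trans (ℚₚ.≤-reflexive (sym (ℚₚ.*-zeroʳ x))) (*-monoˡ-≤-0≤ 0≤x 0≤y)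

  ^ℚ-nonNeg : ∀ {x} e → 0ℚ ℚ.≤ x → 0ℚ ℚ.≤ x ^ℚ e
  ^ℚ-nonNeg zero    0≤x = ℕtoℚ-nonNeg 1
  ^ℚ-nonNeg (suc e) 0≤x = 0≤* 0≤x (^ℚ-nonNeg e 0≤x)

  ^ℚ-distrib-* : ∀ x y e → (x ℚ.* y) ^ℚ e ≡ x ^ℚ e ℚ.* y ^ℚ e
  ^ℚ-distrib-* x y zero    = refl
  ^ℚ-distrib-* x y (suc e) = trans (cong ((x ℚ.* y) ℚ.*_) (^ℚ-distrib-* x y e)) (ℚ-interchange x y (x ^ℚ e) (y ^ℚ e))

  ^ℚ-mono-< : ∀ {x y} e → 0ℚ ℚ.≤ x → x ℚ.< y → x ^ℚ suc e ℚ.< y ^ℚ suc e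
  ^ℚ-mono-< zero    0≤x x<y = ℚₚ.*-monoˡ-<-pos 1ℚ x<y
  ^ℚ-mono-< {x} {y} (suc e) 0≤x x<y =
    ℚₚ.≤-<-trans (*-monoˡ-≤-0≤ 0≤x (ℚₚ.<⇒≤ xᵉ<yᵉ)) (ℚₚ.*-monoˡ-<-pos (y ^ℚ suc e) {{ℚ.positive 0<yᵉ}} x<y)
    where
    xᵉ<yᵉ = ^ℚ-mono-< e 0≤x x<y
    0<yᵉ = ℚₚ.≤-<-trans (^ℚ-nonNeg (suc e) 0≤x) xᵉ<yᵉ

  ^ℚ-cancel-≤ : ∀ {x y} e → 0ℚ ℚ.≤ y → x ^ℚ suc e ℚ.≤ y ^ℚ suc e → x ℚ.≤ y
  ^ℚ-cancel-≤ {x} {y} e 0≤y xᵉ≤yᵉ with x ℚₚ.≤? y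
  ... | yes x≤y = x≤y
  ... | no  x≰y = contradiction (ℚₚ.<-≤-trans (^ℚ-mono-< e 0≤y (ℚₚ.≰⇒> x≰y)) xᵉ≤yᵉ) (ℚₚ.<-irrefl refl)

  sumFin-ℕtoℚ : ∀ m (f : Fin m → ℕ) → sumFin m (ℕtoℚ ∘ f) ≡ ℕtoℚ (sum f)
  sumFin-ℕtoℚ zero    f = refl
  sumFin-ℕtoℚ (suc m) f = trans (cong (ℕtoℚ (f zero) ℚ.+_) (sumFin-ℕtoℚ m (f ∘ suc))) (sym (ℕtoℚ-+ (f zero) _))

  prodFin-ℕtoℚ : ∀ m (f : Fin m → ℕ) → prodFin m (ℕtoℚ ∘ f) ≡ ℕtoℚ (∏ f)
  prodFin-ℕtoℚ zero    f = refl
  prodFin-ℕtoℚ (suc m) f = trans (cong (ℕtoℚ (f zero) ℚ.*_) (prodFin-ℕtoℚ m (f ∘ suc))) (sym (ℕtoℚ-* (f zero) _))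

  prodFin-cong : ∀ m {f g : Fin m → ℚ} → (∀ i → f i ≡ g i) → prodFin m f ≡ prodFin m g
  prodFin-cong zero    f≗g = refl
  prodFin-cong (suc m) f≗g = cong₂ ℚ._*_ (f≗g zero) (prodFin-cong m (f≗g ∘ suc))

  sumFin-cong : ∀ m {f g : Fin m → ℚ} → (∀ i → f i ≡ g i) → sumFin m f ≡ sumFin m g
  sumFin-cong zero    f≗g = refl
  sumFin-cong (suc m) f≗g = cong₂ ℚ._+_ (f≗g zero) (sumFin-cong m (f≗g ∘ suc))

  sumFun-cong : ∀ k m {f g : (Fin k → Fin m) → ℚ} → (∀ z → f z ≡ g z) → sumFun k m f ≡ sumFun k m g
  sumFun-cong zero    m f≗g = f≗g _
  sumFun-cong (suc k) m f≗g = sumFin-cong m λ a → sumFun-cong k m (f≗g ∘ (a ◂_))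

  sumFun-ℕtoℚ : ∀ k m (f : (Fin k → Fin m) → ℕ) → sumFun k m (ℕtoℚ ∘ f) ≡ ℕtoℚ (sumFunℕ k m f)
  sumFun-ℕtoℚ zero    m f = refl
  sumFun-ℕtoℚ (suc k) m f = trans (sumFin-cong m λ a → sumFun-ℕtoℚ k m (f ∘ (a ◂_))) (sumFin-ℕtoℚ m _)

  ℕtoℚ*inv≤inv*ℕtoℚ⇒≤ : ∀ c a b e .{{_ : NonZero a}} .{{_ : NonZero b}} →
    ℕtoℚ c ℚ.* inv a ℚ.≤ inv b ℚ.* ℕtoℚ e → c * b ≤ e * a
  ℕtoℚ*inv≤inv*ℕtoℚ⇒≤ c a b e ca⁻¹≤b⁻¹e = ℕtoℚ-cancel-≤ (begin
    ℕtoℚ (c * b)                             ≡⟨ ℕtoℚ-* c b ⟩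
    ℕtoℚ c ℚ.* ℕtoℚ b                        ≡⟨ ℚₚ.*-identityʳ (ℕtoℚ c ℚ.* ℕtoℚ b) ⟨
    ℕtoℚ c ℚ.* ℕtoℚ b ℚ.* 1ℚ                 ≡⟨ cong (ℕtoℚ c ℚ.* ℕtoℚ b ℚ.*_) (trans (ℚₚ.*-comm (ℕtoℚ a) (inv a)) (inv*ℕtoℚ a)) ⟨
    ℕtoℚ c ℚ.* ℕtoℚ b ℚ.* (ℕtoℚ a ℚ.* inv a) ≡⟨ ℚ-interchange (ℕtoℚ c) (ℕtoℚ b) (ℕtoℚ a) (inv a) ⟩
    ℕtoℚ c ℚ.* ℕtoℚ a ℚ.* (ℕtoℚ b ℚ.* inv a) ≡⟨ cong (ℕtoℚ c ℚ.* ℕtoℚ a ℚ.*_) (ℚₚ.*-comm (ℕtoℚ b) (inv a)) ⟩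
    ℕtoℚ c ℚ.* ℕtoℚ a ℚ.* (inv a ℚ.* ℕtoℚ b) ≡⟨ ℚ-interchange (ℕtoℚ c) (ℕtoℚ a) (inv a) (ℕtoℚ b) ⟩
    ℕtoℚ c ℚ.* inv a ℚ.* (ℕtoℚ a ℚ.* ℕtoℚ b) ≤⟨ *-monoʳ-≤-0≤ (0≤* (ℕtoℚ-nonNeg a) (ℕtoℚ-nonNeg b)) ca⁻¹≤b⁻¹e ⟩
    inv b ℚ.* ℕtoℚ e ℚ.* (ℕtoℚ a ℚ.* ℕtoℚ b) ≡⟨ ℚ-interchange (inv b) (ℕtoℚ e) (ℕtoℚ a) (ℕtoℚ b) ⟩
    inv b ℚ.* ℕtoℚ a ℚ.* (ℕtoℚ e ℚ.* ℕtoℚ b) ≡⟨ cong (ℚ._* (ℕtoℚ e ℚ.* ℕtoℚ b)) (ℚₚ.*-comm (inv b) (ℕtoℚ a)) ⟩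
    ℕtoℚ a ℚ.* inv b ℚ.* (ℕtoℚ e ℚ.* ℕtoℚ b) ≡⟨ ℚ-interchange (ℕtoℚ a) (inv b) (ℕtoℚ e) (ℕtoℚ b) ⟩
    ℕtoℚ a ℚ.* ℕtoℚ e ℚ.* (inv b ℚ.* ℕtoℚ b) ≡⟨ cong (ℕtoℚ a ℚ.* ℕtoℚ e ℚ.*_) (inv*ℕtoℚ b) ⟩
    ℕtoℚ a ℚ.* ℕtoℚ e ℚ.* 1ℚ                 ≡⟨ ℚₚ.*-identityʳ (ℕtoℚ a ℚ.* ℕtoℚ e) ⟩
    ℕtoℚ a ℚ.* ℕtoℚ e                        ≡⟨ trans (ℕtoℚ-* e a) (ℚₚ.*-comm (ℕtoℚ e) (ℕtoℚ a)) ⟨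
    ℕtoℚ (e * a)                             ∎)
    where open ℚₚ.≤-Reasoning

  inv*ℕtoℚ≤ : ∀ a b c .{{_ : NonZero b}} → a ≤ b * c → inv b ℚ.* ℕtoℚ a ℚ.≤ ℕtoℚ c
  inv*ℕtoℚ≤ a b c a≤bc = begin
    inv b ℚ.* ℕtoℚ a              ≤⟨ *-monoˡ-≤-0≤ (ℚₚ.<⇒≤ (inv-pos b)) (ℕtoℚ-mono-≤ a≤bc) ⟩
    inv b ℚ.* ℕtoℚ (b * c)        ≡⟨ cong (inv b ℚ.*_) (ℕtoℚ-* b c) ⟩
    inv b ℚ.* (ℕtoℚ b ℚ.* ℕtoℚ c) ≡⟨ ℚₚ.*-assoc (inv b) (ℕtoℚ b) (ℕtoℚ c) ⟨
    inv b ℚ.* ℕtoℚ b ℚ.* ℕtoℚ c   ≡⟨ cong (ℚ._* ℕtoℚ c) (inv*ℕtoℚ b) ⟩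
    1ℚ ℚ.* ℕtoℚ c                 ≡⟨ ℚₚ.*-identityˡ (ℕtoℚ c) ⟩
    ℕtoℚ c                        ∎
    where open ℚₚ.≤-Reasoning

  -- Permutations and the Cayley forms on indicator test vectors

  allFinB⇒∀ : ∀ m (f : Fin m → Bool) → allFinB m f ≡ true → ∀ i → f i ≡ true
  allFinB⇒∀ (suc m) f all i with f zero in f₀
  allFinB⇒∀ (suc m) f all zero    | true = f₀
  allFinB⇒∀ (suc m) f all (suc i) | true = allFinB⇒∀ m (f ∘ suc) all i

  ∀⇒allFinB : ∀ m (f : Fin m → Bool) → (∀ i → f i ≡ true) → allFinB m f ≡ true
  ∀⇒allFinB zero    f all = refl
  ∀⇒allFinB (suc m) f all rewrite all zero = ∀⇒allFinB m (f ∘ suc) (all ∘ suc)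

  allFinB-cong : ∀ m {f g : Fin m → Bool} → (∀ i → f i ≡ g i) → allFinB m f ≡ allFinB m g
  allFinB-cong zero    f≗g = refl
  allFinB-cong (suc m) f≗g = cong₂ _∧_ (f≗g zero) (allFinB-cong m (f≗g ∘ suc))

  isPerm-cong : ∀ m {σ τ : Fin m → Fin m} → (∀ i → σ i ≡ τ i) → isPerm m σ ≡ isPerm m τ
  isPerm-cong m σ≗τ = allFinB-cong m λ i → allFinB-cong m λ j →
    cong₂ (λ a b → if ⌊ a ≟ b ⌋ then ⌊ i ≟ j ⌋ else true) (σ≗τ i) (σ≗τ j)

  isPerm-id : ∀ m → isPerm m id ≡ true
  isPerm-id m = ∀⇒allFinB m _ λ i → ∀⇒allFinB m _ λ j → lemma i j
    where
    lemma : ∀ (i j : Fin m) → (if ⌊ i ≟ j ⌋ then ⌊ i ≟ j ⌋ else true) ≡ true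
    lemma i j with i ≟ j
    ... | yes _ = refl
    ... | no _  = refl

  isPerm⇒injective : ∀ m (σ : Fin m → Fin m) → isPerm m σ ≡ true → ∀ {i j} → σ i ≡ σ j → i ≡ j
  isPerm⇒injective m σ perm {i} {j} σi≡σj with σ i ≟ σ j | i ≟ j | allFinB⇒∀ m _ (allFinB⇒∀ m _ perm i) j
  ... | yes _    | yes i≡j | _  = i≡j
  ... | yes _    | no _    | ()
  ... | no σi≢σj | _       | _  = contradiction σi≡σj σi≢σj

  injective⇒surjective : ∀ m (σ : Fin m → Fin m) → (∀ {i j} → σ i ≡ σ j → i ≡ j) → ∀ y → ∃ λ j → σ j ≡ y
  injective⇒surjective (suc m) σ σ-inj y with Finₚ.any? (λ j → σ j ≟ y)
  ... | yes hit = hit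
  ... | no miss = contradiction (Finₚ.injective⇒≤ σ′-inj) 1+n≰n
    where
    σ′ : Fin (suc m) → Fin m
    σ′ j = punchOut {i = y} (λ eq → miss (j , sym eq))
    σ′-inj : ∀ {i j} → σ′ i ≡ σ′ j → i ≡ j
    σ′-inj {i} {j} eq = σ-inj (Finₚ.punchOut-injective {i = y} (λ e → miss (i , sym e)) (λ e → miss (j , sym e)) eq)

  ∑-isPerm : ∀ m (σ : Fin m → Fin m) → isPerm m σ ≡ true → (g : Fin m → ℕ) → ∑[ j < m ] g (σ j) ≡ sum g
  ∑-isPerm m σ perm g = sym (∑-permute g π)
    where
    σ-inj = isPerm⇒injective m σ perm
    σ⁻¹ = λ y → proj₁ (injective⇒surjective m σ σ-inj y)
    π : Permutation′ m
    π = mk↔ₛ′ σ σ⁻¹ (λ y → proj₂ (injective⇒surjective m σ σ-inj y)) (λ x → σ-inj (proj₂ (injective⇒surjective m σ σ-inj (σ x))))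

  module TestVectors (p : ℕ) .{{_ : NonZero p}} (n : ℕ) (colour : Γ p n → Fin p) where

    open Modular p

    testVector : (Fin p → Fin p) → Fin p → Γ p n → ℚ
    testVector a j u = ℕtoℚ (kronecker (colour u) (a j))

    edgeCount : (Fin p → Fin p) → Γ p n → (Fin p → Fin p) → ℕ
    edgeCount a v σ = if isPerm p σ then sumFunℕ n p (λ u → ∏ (λ j → kronecker (colour (line u v (toℕ (σ j)))) (a j))) else 0

    cayleyCount : (Fin p → Fin p) → Γ p n → ℕ
    cayleyCount a v = sumFunℕ p p (edgeCount a v)

    barAv-testVector : ∀ a v → barAv p n v (testVector a) ≡ ℕtoℚ (cayleyCount a v)
    barAv-testVector a v = trans (sumFun-cong p p perEdge) (sumFun-ℕtoℚ p p (edgeCount a v))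
      where
      if-ℕtoℚ : ∀ b x → (if b then ℕtoℚ x else 0ℚ) ≡ ℕtoℚ (if b then x else 0)
      if-ℕtoℚ true  x = refl
      if-ℕtoℚ false x = refl
      perEdge : ∀ σ → (if isPerm p σ then sumFun n p (λ u → prodFin p (λ j → testVector a j (line u v (toℕ (σ j))))) else 0ℚ)
                      ≡ ℕtoℚ (edgeCount a v σ)
      perEdge σ = trans (cong (λ x → if isPerm p σ then x else 0ℚ)
                              (trans (sumFun-cong n p λ u → prodFin-ℕtoℚ p _) (sumFun-ℕtoℚ n p _)))
                        (if-ℕtoℚ (isPerm p σ) _)

    AK-testVector : ∀ a → AK p n (testVector a) ≡ ℕtoℚ (sumFunℕ n p (cayleyCount a)) ℚ.* inv (p ! * p ^ n)
    AK-testVector a = cong (ℚ._* inv (p ! * p ^ n))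
      (trans (sumFun-cong n p (barAv-testVector a)) (sumFun-ℕtoℚ n p (cayleyCount a)))

    AH-testVector : ∀ a (S : List (Γ p n)) → (∀ s → cayleyCount a (lookup S s) ≡ 0) → AH p n S (testVector a) ≡ 0ℚ
    AH-testVector a S none = trans (cong (ℚ._* inv (p ! * length S)) (barA≡0 S none)) (ℚₚ.*-zeroˡ (inv (p ! * length S)))
      where
      barA≡0 : ∀ S → (∀ s → cayleyCount a (lookup S s) ≡ 0) → barA p n S (testVector a) ≡ 0ℚ
      barA≡0 []      none = refl
      barA≡0 (v ∷ S) none = cong₂ ℚ._+_ (trans (barAv-testVector a v) (cong ℕtoℚ (none zero))) (barA≡0 S (none ∘ suc))

    testVector-gap : ∀ a (S : List (Γ p n)) → (∀ s → cayleyCount a (lookup S s) ≡ 0) →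
      ℚ.∣ AH p n S (testVector a) ℚ.- AK p n (testVector a) ∣ ≡ ℕtoℚ (sumFunℕ n p (cayleyCount a)) ℚ.* inv (p ! * p ^ n)
    testVector-gap a S none = begin
      ℚ.∣ AH p n S (testVector a) ℚ.- AK p n (testVector a) ∣ ≡⟨ cong₂ (λ h k → ℚ.∣ h ℚ.- k ∣) (AH-testVector a S none) (AK-testVector a) ⟩
      ℚ.∣ 0ℚ ℚ.- X ∣                                          ≡⟨ cong ℚ.∣_∣ (ℚₚ.+-identityˡ (ℚ.- X)) ⟩
      ℚ.∣ ℚ.- X ∣                                             ≡⟨ ℚₚ.∣-p∣≡∣p∣ X ⟩
      ℚ.∣ X ∣                                                 ≡⟨ ℚₚ.0≤p⇒∣p∣≡p (0≤* (ℕtoℚ-nonNeg (sumFunℕ n p (cayleyCount a))) (0≤inv (p ! * p ^ n))) ⟩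
      X                                                       ∎
      where
      open ≡-Reasoning
      X = ℕtoℚ (sumFunℕ n p (cayleyCount a)) ℚ.* inv (p ! * p ^ n)

    normPow-testVector : ∀ a j → normPow p n (testVector a j) ≡ ℕtoℚ (sumFunℕ n p (λ u → kronecker (colour u) (a j) ^ p))
    normPow-testVector a j = trans (sumFun-cong n p λ u → trans (cong (_^ℚ p) (∣ℕtoℚ∣ (χ u))) (ℕtoℚ-^ (χ u) p)) (sumFun-ℕtoℚ n p _)
      where χ = λ u → kronecker (colour u) (a j)

    ∏-normPow-testVector≤ : ∀ a → prodFin p (λ j → normPow p n (testVector a j)) ℚ.≤ ℕtoℚ ((p ^ n) ^ p)
    ∏-normPow-testVector≤ a = begin
      prodFin p (λ j → normPow p n (testVector a j)) ≡⟨ prodFin-cong p (normPow-testVector a) ⟩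
      prodFin p (ℕtoℚ ∘ norm)                        ≡⟨ prodFin-ℕtoℚ p norm ⟩
      ℕtoℚ (∏ norm)                                  ≤⟨ ℕtoℚ-mono-≤ (∏-mono-≤ norm≤) ⟩
      ℕtoℚ (∏ {p} (λ _ → p ^ n))                     ≡⟨ cong ℕtoℚ (∏-const p (p ^ n)) ⟩
      ℕtoℚ ((p ^ n) ^ p)                             ∎
      where
      open ℚₚ.≤-Reasoning
      norm : Fin p → ℕ
      norm j = sumFunℕ n p (λ u → kronecker (colour u) (a j) ^ p)
      norm≤ : ∀ j → norm j ≤ p ^ n
      norm≤ j = ≤-trans (sumFunℕ-mono-≤ n λ u → kronecker^≤1 (colour u) (a j) p) (≤-reflexive (trans (sumFunℕ-const n 1) (*-identityʳ _)))

    lineColours : Γ p n → Γ p n → Fin p → Fin p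
    lineColours u v j = colour (line u v (toℕ j))

    unbalanced : (Fin p → Fin p) → ℕ
    unbalanced a = if ⌊ sum (toℕ ∘ a) ≟ₚ 0 ⌋ then 0 else 1

    unbalanced-extensional : Extensional unbalanced
    unbalanced-extensional a≗b = cong (λ s → if ⌊ s ≟ₚ 0 ⌋ then 0 else 1) (sum-cong-≗ {p} (cong toℕ ∘ a≗b))

    unbalanced≡0⊎1 : ∀ a → unbalanced a ≡ 0 ⊎ unbalanced a ≡ 1
    unbalanced≡0⊎1 a with sum (toℕ ∘ a) ≟ₚ 0
    ... | yes _ = inj₁ refl
    ... | no _  = inj₂ refl

    unbalanced⇒∑≢ₚ0 : ∀ a → unbalanced a ≡ 1 → ¬ (sum (toℕ ∘ a) ≡ₚ 0)
    unbalanced⇒∑≢ₚ0 a ua≡1 with sum (toℕ ∘ a) ≟ₚ 0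
    ... | no ∑≢0 = ∑≢0

    edgeCount-extensional : ∀ a v → Extensional (edgeCount a v)
    edgeCount-extensional a v {σ} {τ} σ≗τ rewrite isPerm-cong p σ≗τ with isPerm p τ
    ... | true  = sumFunℕ-cong n λ u → ∏-cong {p} λ j → cong (λ i → kronecker (colour (line u v (toℕ i))) (a j)) (σ≗τ j)
    ... | false = refl

    cayleyCount-unbalanced : ∀ v → (∀ u → sum (toℕ ∘ lineColours u v) ≡ₚ 0) → ∀ a → unbalanced a ≡ 1 → cayleyCount a v ≡ 0
    cayleyCount-unbalanced v balancedLines a ua≡1 =
      trans (sumFunℕ-cong p noEdge) (trans (sumFunℕ-const p 0) (*-zeroʳ (p ^ p)))
      where
      noEdge : ∀ σ → edgeCount a v σ ≡ 0
      noEdge σ with isPerm p σ in perm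
      ... | false = refl
      ... | true  = trans (sumFunℕ-cong n noEdgeAt) (trans (sumFunℕ-const n 0) (*-zeroʳ (p ^ n)))
        where
        noEdgeAt : ∀ u → ∏ (λ j → kronecker (lineColours u v (σ j)) (a j)) ≡ 0
        noEdgeAt u with Finₚ.all? (λ j → lineColours u v (σ j) ≟ a j)
        ... | no mismatch with Finₚ.¬∀⟶∃¬ p _ (λ j → lineColours u v (σ j) ≟ a j) mismatch
        ...   | j , differ = ∏-zero _ j (kronecker-≢ differ)
        noEdgeAt u | yes match = contradiction (begin
          sum (toℕ ∘ a) % p                          ≡⟨ cong (_% p) (sum-cong-≗ {p} λ j → cong toℕ (sym (match j))) ⟩
          ∑[ j < p ] toℕ (lineColours u v (σ j)) % p ≡⟨ cong (_% p) (∑-isPerm p σ perm (toℕ ∘ lineColours u v)) ⟩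
          sum (toℕ ∘ lineColours u v) % p            ≡⟨ balancedLines u ⟩
          0 % p                                    ∎) (unbalanced⇒∑≢ₚ0 a ua≡1)
          where open ≡-Reasoning

    ∑-unbalancedLines≤ : sumFunℕ n p (λ v → sumFunℕ n p (λ u → unbalanced (lineColours u v)))
                          ≤ sumFunℕ p p (λ a → unbalanced a * sumFunℕ n p (cayleyCount a))
    ∑-unbalancedLines≤ = begin
      sumFunℕ n p (λ v → sumFunℕ n p (λ u → unbalanced (lineColours u v)))
        ≡⟨ sumFunℕ-cong n (λ v → sumFunℕ-cong n λ u → sym (sumFunℕ-kronecker p (lineColours u v) unbalanced unbalanced-extensional)) ⟩
      sumFunℕ n p (λ v → sumFunℕ n p (λ u → sumFunℕ p p (λ a → E a v u * unbalanced a)))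
        ≡⟨ trans (sumFunℕ-cong n λ v → sumFunℕ-comm n p p p _) (sumFunℕ-comm n p p p _) ⟩
      sumFunℕ p p (λ a → sumFunℕ n p (λ v → sumFunℕ n p (λ u → E a v u * unbalanced a)))
        ≡⟨ sumFunℕ-cong p (λ a → trans (sumFunℕ-cong n λ v → trans (sumFunℕ-cong n λ u → *-comm (E a v u) _) (sym (sumFunℕ-*ˡ n (unbalanced a) (E a v))))
                                        (sym (sumFunℕ-*ˡ n (unbalanced a) (λ v → sumFunℕ n p (E a v))))) ⟩
      sumFunℕ p p (λ a → unbalanced a * sumFunℕ n p (λ v → sumFunℕ n p (E a v)))
        ≤⟨ sumFunℕ-mono-≤ p (λ a → *-monoʳ-≤ (unbalanced a) (sumFunℕ-mono-≤ n (identityTerm≤ a))) ⟩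
      sumFunℕ p p (λ a → unbalanced a * sumFunℕ n p (cayleyCount a)) ∎
      where
      open ≤-Reasoning
      E : (Fin p → Fin p) → Γ p n → Γ p n → ℕ
      E a v u = ∏ (λ j → kronecker (lineColours u v j) (a j))
      identityTerm≤ : ∀ a v → sumFunℕ n p (E a v) ≤ cayleyCount a v
      identityTerm≤ a v = begin
        sumFunℕ n p (E a v) ≡⟨ cong (λ b → if b then sumFunℕ n p (E a v) else 0) (isPerm-id p) ⟨
        edgeCount a v id    ≤⟨ term≤sumFunℕ p (edgeCount a v) (edgeCount-extensional a v) id ⟩
        cayleyCount a v     ∎

  -- The lower bound

  module Main (p : ℕ) .{{_ : NonZero p}} (isPrime : Prime p) where

    open Modular p

    d : ℕ
    d = p ∸ 1

    p>1 : 1 < p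
    p>1 = 1<p isPrime

    d<p : d < p
    d<p = ≤-reflexive (suc-pred p)

    d!*≡ₚ0⇒≡ₚ0 : ∀ x → d ! * x ≡ₚ 0 → x ≡ₚ 0
    d!*≡ₚ0⇒≡ₚ0 x d!x≡0 with euclidsLemma (d !) x isPrime (≡ₚ0⇒∣ d!x≡0)
    ... | inj₁ p∣d! = contradiction p∣d! (p∤n! isPrime d<p)
    ... | inj₂ p∣x  = ∣⇒≡ₚ0 p∣x

    ≡ₚ0⇒d!*≡ₚ0 : ∀ x → x ≡ₚ 0 → d ! * x ≡ₚ 0
    ≡ₚ0⇒d!*≡ₚ0 x x≡0 = trans (*-congˡₚ (d !) x≡0) (cong (_% p) (*-zeroʳ (d !)))

    -- The factor 2 leaves room to turn ε ≤ ε₀ into a strict contradiction in ℕ.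
    Q : ℕ
    Q = 2 * p ^ p * (2 ^ d * p ^ d)

    M : ℕ
    M = p ! * Q

    instance
      Q≢0 : NonZero Q
      Q≢0 = m*n≢0 (2 * p ^ p) (2 ^ d * p ^ d) {{m*n≢0 2 (p ^ p) {{_}} {{m^n≢0 p p}}}} {{m*n≢0 (2 ^ d) (p ^ d) {{m^n≢0 2 d}} {{m^n≢0 p d}}}}

      M≢0 : NonZero M
      M≢0 = m*n≢0 (p !) Q {{p !≢0}}

    ε₀ : ℚ
    ε₀ = inv M

    B : ℕ
    B = (2 * p) ^ d

    instance
      B≢0 : NonZero B
      B≢0 = m^n≢0 (2 * p) d {{m*n≢0 2 p}}

    δ : ℚ
    δ = inv B

    module Dimension (n : ℕ) where

      m : ℕ
      m = n / p

      d*m≤n : d * m ≤ n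
      d*m≤n = begin
        d * m ≤⟨ *-monoˡ-≤ m (m∸n≤m p 1) ⟩
        p * m ≡⟨ *-comm p m ⟩
        m * p ≤⟨ m/n*n≤m n p ⟩
        n     ∎
        where open ≤-Reasoning

      pos : Fin d → Fin m → Fin n
      pos k i = inject≤ (combine k i) d*m≤n

      pos-injective : ∀ {k i k′ i′} → pos k i ≡ pos k′ i′ → k ≡ k′ × i ≡ i′
      pos-injective {k} {i} {k′} {i′} eq = Finₚ.combine-injective k i k′ i′ (Finₚ.inject≤-injective d*m≤n d*m≤n _ _ eq)

      open BlockForms p n d m pos pos-injective public

      module Colouring (T : Fin N → ℕ) where

        colour : Γ p n → Fin p
        colour w = blockForm T w mod p

        open TestVectors p n colour public

        ∑-lineColours≡ₚ : ∀ u v → sum (toℕ ∘ lineColours u v) ≡ₚ d ! * blockForm T v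
        ∑-lineColours≡ₚ u v = trans (∑-congₚ {p} λ j → trans (cong (_% p) (toℕ-mod _)) (%≡ₚ _))
                                    (∑-line-blockForm isPrime (suc-pred p) T u v)

        unbalancedLine≡nonvanishing : ∀ u v → unbalanced (lineColours u v) ≡ nonvanishing p>1 T v
        unbalancedLine≡nonvanishing u v with sum (toℕ ∘ lineColours u v) ≟ₚ 0 | blockForm T v ≟ₚ 0
        ... | yes _      | yes _    = refl
        ... | no _       | no _     = refl
        ... | yes ∑≡0    | no F≢0   = contradiction (d!*≡ₚ0⇒≡ₚ0 _ (trans (sym (∑-lineColours≡ₚ u v)) ∑≡0)) F≢0
        ... | no ∑≢0     | yes F≡0  = contradiction (trans (∑-lineColours≡ₚ u v) (≡ₚ0⇒d!*≡ₚ0 _ F≡0)) ∑≢0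

        cayleyCount-bound : ∀ (S : List (Γ p n)) ε → ε ℚ.≤ ε₀ → normLe p n S ε →
          (∀ s → blockForm T (lookup S s) ≡ₚ 0) → ∀ a → unbalanced a ≡ 1 →
          sumFunℕ n p (cayleyCount a) * Q ≤ p ^ n * p ^ n
        cayleyCount-bound S ε ε≤ε₀ (0≤ε , bounded) vanish a ua≡1 = *-cancelˡ-≤ (p !) {{p !≢0}} p!EQ≤p!PP
          where
          E = sumFunℕ n p (cayleyCount a)
          P = p ^ n
          A = p ! * P
          A≢0 : NonZero A
          A≢0 = m*n≢0 (p !) P {{p !≢0}} {{m^n≢0 p n}}
          X = ℕtoℚ E ℚ.* inv A
          noEdges : ∀ s → cayleyCount a (lookup S s) ≡ 0
          noEdges s = cayleyCount-unbalanced (lookup S s) (λ u → trans (∑-lineColours≡ₚ u (lookup S s)) (≡ₚ0⇒d!*≡ₚ0 _ (vanish s))) a ua≡1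
          Xᵖ≤[εP]ᵖ : X ^ℚ p ℚ.≤ (ε ℚ.* ℕtoℚ P) ^ℚ p
          Xᵖ≤[εP]ᵖ = begin
            X ^ℚ p                                                       ≡⟨ cong (_^ℚ p) (testVector-gap a S noEdges) ⟨
            ℚ.∣ AH p n S (testVector a) ℚ.- AK p n (testVector a) ∣ ^ℚ p ≤⟨ bounded (testVector a) ⟩
            ε ^ℚ p ℚ.* prodFin p (λ j → normPow p n (testVector a j))    ≤⟨ *-monoˡ-≤-0≤ (^ℚ-nonNeg p 0≤ε) (∏-normPow-testVector≤ a) ⟩
            ε ^ℚ p ℚ.* ℕtoℚ (P ^ p)                                      ≡⟨ cong (ε ^ℚ p ℚ.*_) (ℕtoℚ-^ P p) ⟨
            ε ^ℚ p ℚ.* ℕtoℚ P ^ℚ p                                       ≡⟨ ^ℚ-distrib-* ε (ℕtoℚ P) p ⟨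
            (ε ℚ.* ℕtoℚ P) ^ℚ p                                          ∎
            where open ℚₚ.≤-Reasoning
          X≤M⁻¹P : X ℚ.≤ inv M ℚ.* ℕtoℚ P
          X≤M⁻¹P = ℚₚ.≤-trans
            (^ℚ-cancel-≤ d (0≤* 0≤ε (ℕtoℚ-nonNeg P)) (subst (λ k → X ^ℚ k ℚ.≤ (ε ℚ.* ℕtoℚ P) ^ℚ k) (sym (suc-pred p)) Xᵖ≤[εP]ᵖ))
            (*-monoʳ-≤-0≤ (ℕtoℚ-nonNeg P) ε≤ε₀)
          p!EQ≤p!PP : p ! * (E * Q) ≤ p ! * (P * P)
          p!EQ≤p!PP = begin
            p ! * (E * Q) ≡⟨ x∙yz≈y∙xz (p !) E Q ⟩
            E * M         ≤⟨ ℕtoℚ*inv≤inv*ℕtoℚ⇒≤ E A M P {{A≢0}} X≤M⁻¹P ⟩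
            P * A         ≡⟨ x∙yz≈y∙xz P (p !) P ⟩
            p ! * (P * P) ∎
            where open ≤-Reasoning

        weightedCount : ℕ
        weightedCount = sumFunℕ p p (λ a → unbalanced a * sumFunℕ n p (cayleyCount a))

        p^n*support≤weightedCount : p ^ n * sumFunℕ n p (nonvanishing p>1 T) ≤ weightedCount
        p^n*support≤weightedCount = begin
          p ^ n * sumFunℕ n p (nonvanishing p>1 T)
            ≡⟨ sumFunℕ-*ˡ n (p ^ n) _ ⟩
          sumFunℕ n p (λ v → p ^ n * nonvanishing p>1 T v)
            ≡⟨ sumFunℕ-cong n (λ v → sym (sumFunℕ-const n _)) ⟩
          sumFunℕ n p (λ v → sumFunℕ n p (λ u → nonvanishing p>1 T v))
            ≡⟨ sumFunℕ-cong n (λ v → sumFunℕ-cong n λ u → sym (unbalancedLine≡nonvanishing u v)) ⟩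
          sumFunℕ n p (λ v → sumFunℕ n p (λ u → unbalanced (lineColours u v)))
            ≤⟨ ∑-unbalancedLines≤ ⟩
          weightedCount ∎
          where open ≤-Reasoning

        weightedCount*Q≤ : ∀ (S : List (Γ p n)) ε → ε ℚ.≤ ε₀ → normLe p n S ε →
          (∀ s → blockForm T (lookup S s) ≡ₚ 0) → weightedCount * Q ≤ p ^ p * (p ^ n * p ^ n)
        weightedCount*Q≤ S ε ε≤ε₀ λ≤ε vanish = begin
          weightedCount * Q                                                    ≡⟨ *-comm weightedCount Q ⟩
          Q * weightedCount                                                    ≡⟨ sumFunℕ-*ˡ p Q _ ⟩
          sumFunℕ p p (λ a → Q * (unbalanced a * sumFunℕ n p (cayleyCount a))) ≤⟨ sumFunℕ-mono-≤ p (λ a → ≤-trans (≤-reflexive (*-comm Q _)) (termBound a)) ⟩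
          sumFunℕ p p (λ _ → p ^ n * p ^ n)                                    ≡⟨ sumFunℕ-const p _ ⟩
          p ^ p * (p ^ n * p ^ n)                                              ∎
          where
          open ≤-Reasoning
          termBound : ∀ a → unbalanced a * sumFunℕ n p (cayleyCount a) * Q ≤ p ^ n * p ^ n
          termBound a with unbalanced≡0⊎1 a
          ... | inj₁ u≡0 = ≤-trans (≤-reflexive (cong (λ u → u * sumFunℕ n p (cayleyCount a) * Q) u≡0)) z≤n
          ... | inj₂ u≡1 = ≤-trans (≤-reflexive (trans (cong (λ u → u * sumFunℕ n p (cayleyCount a) * Q) u≡1) (cong (_* Q) (*-identityˡ (sumFunℕ n p (cayleyCount a))))))
                                   (cayleyCount-bound S ε ε≤ε₀ λ≤ε vanish a u≡1)

        vanishing-on-expander : ∀ (S : List (Γ p n)) ε → ε ℚ.≤ ε₀ → normLe p n S ε →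
          (∀ s → blockForm T (lookup S s) ≡ₚ 0) → ∀ t₀ → T t₀ ≡ₚ 0
        vanishing-on-expander S ε ε≤ε₀ λ≤ε vanish t₀ with T t₀ ≟ₚ 0
        ... | yes Tt₀≡0 = Tt₀≡0
        ... | no Tt₀≢0  = contradiction 2X≤X (<⇒≱ (m<m+n X X+0>0))
          where
          P = p ^ n
          X = p ^ p * (P * P)
          support = sumFunℕ n p (nonvanishing p>1 T)
          X+0>0 : 0 < X + 0
          X+0>0 = subst (0 <_) (sym (+-identityʳ X))
            (ℕ.>-nonZero⁻¹ X {{m*n≢0 (p ^ p) (P * P) {{m^n≢0 p p}} {{m*n≢0 P P {{m^n≢0 p n}} {{m^n≢0 p n}}}}}})
          2X≤X : 2 * X ≤ X
          2X≤X = begin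
            2 * X                                         ≡⟨ rearrange (p ^ p) P ⟩
            2 * p ^ p * (P * P)                           ≤⟨ *-monoʳ-≤ (2 * p ^ p) (*-monoʳ-≤ P (blockForm-support p>1 T t₀ Tt₀≢0)) ⟩
            2 * p ^ p * (P * (2 ^ d * (p ^ d * support))) ≡⟨ regroup (2 * p ^ p) P (2 ^ d) (p ^ d) support ⟩
            Q * (P * support)                             ≤⟨ *-monoʳ-≤ Q p^n*support≤weightedCount ⟩
            Q * weightedCount                             ≡⟨ *-comm Q weightedCount ⟩
            weightedCount * Q                             ≤⟨ weightedCount*Q≤ S ε ε≤ε₀ λ≤ε vanish ⟩
            X                                             ∎
            where
            open ≤-Reasoning
            rearrange : ∀ a b → 2 * (a * (b * b)) ≡ 2 * a * (b * b)
            rearrange = solve-∀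
            regroup : ∀ a b c e s → a * (b * (c * (e * s))) ≡ a * (c * e) * (b * s)
            regroup = solve-∀

    expander-size : ∀ n (S : List (Γ p n)) ε → ε ℚ.≤ ε₀ → normLe p n S ε → Dimension.N n ≤ length S
    expander-size n S ε ε≤ε₀ λ≤ε = ≮⇒≥ small⇒⊥
      where
      open Dimension n
      small⇒⊥ : ¬ (length S < N)
      small⇒⊥ small =
        let T , t₀ , Tt₀≢0 , vanish = vanishing-blockForm p>1 S small
        in Tt₀≢0 (Colouring.vanishing-on-expander T S ε ε≤ε₀ λ≤ε vanish t₀)

    n^d≤B*N : ∀ n → p ≤ n → n ^ d ≤ B * Dimension.N n
    n^d≤B*N n p≤n = begin
      n ^ d           ≤⟨ ^-monoˡ-≤ d n≤2pm ⟩
      (2 * p * m) ^ d ≡⟨ ^-distribʳ-* (2 * p) m d ⟩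
      B * m ^ d       ∎
      where
      open ≤-Reasoning
      open Dimension n using (m)
      instance
        m≢0 : NonZero m
        m≢0 = ℕ.>-nonZero (m≥n⇒m/n>0 p≤n)
      n≤2pm : n ≤ 2 * p * m
      n≤2pm = begin
        n             ≡⟨ m≡m%n+[m/n]*n n p ⟩
        n % p + m * p ≤⟨ +-monoˡ-≤ (m * p) (≤-trans (<⇒≤ (m%n<n n p)) (m≤n*m p m)) ⟩
        m * p + m * p ≡⟨ double m p ⟩
        2 * p * m     ∎
        where
        double : ∀ m p → m * p + m * p ≡ 2 * p * m
        double = solve-∀
      ^-distribʳ-* : ∀ a b e → (a * b) ^ e ≡ a ^ e * b ^ e
      ^-distribʳ-* a b zero    = refl
      ^-distribʳ-* a b (suc e) = trans (cong ((a * b) *_) (^-distribʳ-* a b e)) (interchange a b (a ^ e) (b ^ e))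

    expander-lower-bound : ∀ n → p ^ 2 ≤ n → ∀ ε → ε ℚ.< ε₀ → (S : List (Γ p n)) → IsArithExpander p n ε S →
      δ ℚ.* ℕtoℚ (n ^ d) ℚ.≤ ℕtoℚ (length S)
    expander-lower-bound n p²≤n ε ε<ε₀ S (_ , λ≤ε) = inv*ℕtoℚ≤ (n ^ d) B (length S) (begin
      n ^ d             ≤⟨ n^d≤B*N n (≤-trans (m≤m*n p (p ^ 1) {{m^n≢0 p 1}}) p²≤n) ⟩
      B * Dimension.N n ≤⟨ *-monoʳ-≤ B (expander-size n S ε (ℚₚ.<⇒≤ ε<ε₀) λ≤ε) ⟩
      B * length S      ∎)
      where open ≤-Reasoning

open import Data.Nat using (ℕ; NonZero; _^_; _∸_) renaming (_≤_ to _≤ℕ_)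
open import Data.Nat.Primality using (Prime)
open import Data.Rational using (ℚ; 0ℚ; _<_; _≤_; _*_)
open import Data.List using (List; length)
open import Data.Product using (Σ; _×_; _,_)

theorem2p1 : (p : ℕ) .{{_ : NonZero p}} → Prime p →
    Σ ℚ (λ ε₀ → Σ ℚ (λ δ → (0ℚ < ε₀) × (0ℚ < δ) ×
    ((n : ℕ) → p ^ 2 ≤ℕ n → (ε : ℚ) → ε < ε₀ → (S' : List (Γ p n)) →
    IsArithExpander p n ε S' →
    (δ * ℕtoℚ (n ^ (p ∸ 1))) ≤ ℕtoℚ (length S'))))
theorem2p1 p isPrime = ε₀ , δ , inv-pos M , inv-pos B , expander-lower-bound
  where open Main p isPrime
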